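{- Let $\varepsilon$ be an integer with $\varepsilon\equiv 2\pmod{4}$. Then there exist infinitely many positive odd integers $n$ with the property that there exist positive integers $d_1, d_2$, both dividing $\frac{n^2+1}{2}$, such that $d_1+d_2=4n+\varepsilon$. -}

module Defs where

open import Data.Nat using (ℕ; _+_; _*_; _/_)

-- (n² + 1) / 2, using ℕ floor division; exact when n is odd.
halfSqPlusOne : ℕ → ℕ
halfSqPlusOne n = (n * n + 1) / 2

-- Write ε = 2e, d₁ = A u, d₂ = A v and 4n = A (u + v) - 2e.  Then d₁ + d₂ = 4n + ε, and
-- (n² + 1) / 2 = m A u v becomes one quadratic equation Φ(u, v) = 0.  When A + t = 8m, the
-- coordinates X = t (u + v) + 2e and D = v - u turn it into X² - N D² = const with N = 8mt,
-- so multiplying X + D√N by a unit a + b√N with a ≡ 1 (mod 8t) and 2t ∣ b maps solutions to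
-- solutions, keeps n odd and makes it grow.  Such a unit is the square of a nontrivial solution
-- of a Pell equation, which exists by Dirichlet approximation and the pigeonhole principle.
-- Explicit polynomial starting points cover ε ≡ 2 and ε ≡ 6 (mod 8).

module Submission where

module Cast where

  open import Data.Integer
  open import Data.Integer.Properties using (pos-+; pos-*)
  open import Data.Nat as ℕ using (ℕ)
  open import Relation.Binary.PropositionalEquality

  -- Natural-number expressions built from constants and squares of integers, so that
  -- a single lemma transports them to ℤ; squares make nonnegativity evident.
  infixl 6 _⊕_
  infixl 7 _⊗_
  infix 8 ‵_ □_

  data Term : Set where
    ‵_ : ℕ → Term
    □_ : ℤ → Term
    _⊕_ _⊗_ : Term → Term → Term

  ⟦_⟧ℕ : Term → ℕ
  ⟦ ‵ n ⟧ℕ = n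
  ⟦ □ i ⟧ℕ = ∣ i ∣ ℕ.* ∣ i ∣
  ⟦ s ⊕ s′ ⟧ℕ = ⟦ s ⟧ℕ ℕ.+ ⟦ s′ ⟧ℕ
  ⟦ s ⊗ s′ ⟧ℕ = ⟦ s ⟧ℕ ℕ.* ⟦ s′ ⟧ℕ

  ⟦_⟧ℤ : Term → ℤ
  ⟦ ‵ n ⟧ℤ = + n
  ⟦ □ i ⟧ℤ = i * i
  ⟦ s ⊕ s′ ⟧ℤ = ⟦ s ⟧ℤ + ⟦ s′ ⟧ℤ
  ⟦ s ⊗ s′ ⟧ℤ = ⟦ s ⟧ℤ * ⟦ s′ ⟧ℤ

  pos-∣i∣*∣i∣ : ∀ i → + (∣ i ∣ ℕ.* ∣ i ∣) ≡ i * i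
  pos-∣i∣*∣i∣ (+ n) = pos-* n n
  pos-∣i∣*∣i∣ -[1+ n ] = refl

  pos-⟦⟧ : ∀ s → + ⟦ s ⟧ℕ ≡ ⟦ s ⟧ℤ
  pos-⟦⟧ (‵ n) = refl
  pos-⟦⟧ (□ i) = pos-∣i∣*∣i∣ i
  pos-⟦⟧ (s ⊕ s′) = trans (pos-+ ⟦ s ⟧ℕ ⟦ s′ ⟧ℕ) (cong₂ _+_ (pos-⟦⟧ s) (pos-⟦⟧ s′))
  pos-⟦⟧ (s ⊗ s′) = trans (pos-* ⟦ s ⟧ℕ ⟦ s′ ⟧ℕ) (cong₂ _*_ (pos-⟦⟧ s) (pos-⟦⟧ s′))

module Dirichlet where

  open import Data.Nat
  open import Data.Nat.Properties
  open import Data.Nat.Tactic.RingSolver using (solve-∀)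
  open import Data.Empty using (⊥-elim)
  open import Data.Fin as Fin using (Fin; toℕ; fromℕ<)
  open import Data.Fin.Properties using (pigeonhole; fromℕ<-injective; toℕ<n)
  open import Data.Product using (∃; ∃₂; _×_; _,_; proj₁; proj₂)
  open import Relation.Nullary using (yes; no)
  open import Relation.Binary.PropositionalEquality

  m<n⇒m*m<n*n : ∀ {m n} → m < n → m * m < n * n
  m<n⇒m*m<n*n m<n = *-mono-< m<n m<n

  m≤n⇒m*m≤n*n : ∀ {m n} → m ≤ n → m * m ≤ n * n
  m≤n⇒m*m≤n*n m≤n = *-mono-≤ m≤n m≤n

  m*m≤n*n⇒m≤n : ∀ {m n} → m * m ≤ n * n → m ≤ n
  m*m≤n*n⇒m≤n {m} {n} m²≤n² with m ≤? n
  ... | yes m≤n = m≤n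
  ... | no m≰n = ⊥-elim (<⇒≱ (m<n⇒m*m<n*n (≰⇒> m≰n)) m²≤n²)

  m*m<n*n⇒m<n : ∀ {m n} → m * m < n * n → m < n
  m*m<n*n⇒m<n {m} {n} m²<n² with m <? n
  ... | yes m<n = m<n
  ... | no m≮n = ⊥-elim (<⇒≱ m²<n² (m≤n⇒m*m≤n*n (≮⇒≥ m≮n)))

  opaque
    floorSqrt : ∀ n → ∃ λ r → r * r ≤ n × n < suc r * suc r
    floorSqrt zero = 0 , z≤n , s≤s z≤n
    floorSqrt (suc n) with floorSqrt n
    ... | r , r²≤n , n<[1+r]² with suc r * suc r ≤? suc n
    ...   | yes [1+r]²≤1+n = suc r , [1+r]²≤1+n , ≤-<-trans n<[1+r]² (m<n⇒m*m<n*n (n<1+n (suc r)))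
    ...   | no [1+r]²≰1+n = r , m≤n⇒m≤1+n r²≤n , ≰⇒> [1+r]²≰1+n

  ⌊√_⌋ : ℕ → ℕ
  ⌊√ n ⌋ = proj₁ (floorSqrt n)

  ⌊√n⌋²≤n : ∀ n → ⌊√ n ⌋ * ⌊√ n ⌋ ≤ n
  ⌊√n⌋²≤n n = proj₁ (proj₂ (floorSqrt n))

  n<[1+⌊√n⌋]² : ∀ n → n < suc ⌊√ n ⌋ * suc ⌊√ n ⌋
  n<[1+⌊√n⌋]² n = proj₂ (proj₂ (floorSqrt n))

  m*m≤n⇒m≤⌊√n⌋ : ∀ m n → m * m ≤ n → m ≤ ⌊√ n ⌋
  m*m≤n⇒m≤⌊√n⌋ m n m²≤n = ≤-pred (m*m<n*n⇒m<n (≤-<-trans m²≤n (n<[1+⌊√n⌋]² n)))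

  n<m*m⇒⌊√n⌋<m : ∀ m n → n < m * m → ⌊√ n ⌋ < m
  n<m*m⇒⌊√n⌋<m m n n<m² = m*m<n*n⇒m<n (≤-<-trans (⌊√n⌋²≤n n) n<m²)

  private
    square-+ : ∀ a b → (a + b) * (a + b) ≡ a * a + 2 * (a * b) + b * b
    square-+ = solve-∀

    N-square-+ : ∀ N X Y → N * ((X + Y) * (X + Y)) ≡ N * (X * X) + 2 * (N * X * Y) + N * (Y * Y)
    N-square-+ = solve-∀

    square-* : ∀ a b → (a * b) * (a * b) ≡ (a * a) * (b * b)
    square-* = solve-∀

    N-square-* : ∀ N X Y → (N * X * Y) * (N * X * Y) ≡ (N * (X * X)) * (N * (Y * Y))
    N-square-* = solve-∀

    rescale : ∀ N B q → N * ((B * q) * (B * q)) ≡ B * B * (N * (q * q))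
    rescale = solve-∀

    square-*ˡ : ∀ B f → (B * f) * (B * f) ≡ B * B * (f * f)
    square-*ˡ = solve-∀

  module _ (N : ℕ) where

    -- In the following, a * a ≤ N * (X * X) stands for a ≤ X √N.

    ≤√-* : ∀ a b X Y → a * a ≤ N * (X * X) → b * b ≤ N * (Y * Y) → a * b ≤ N * X * Y
    ≤√-* a b X Y a≤X√N b≤Y√N = m*m≤n*n⇒m≤n (begin
      (a * b) * (a * b)                 ≡⟨ square-* a b ⟩
      (a * a) * (b * b)                 ≤⟨ *-mono-≤ a≤X√N b≤Y√N ⟩
      (N * (X * X)) * (N * (Y * Y))     ≡⟨ N-square-* N X Y ⟨
      (N * X * Y) * (N * X * Y)         ∎)
      where open ≤-Reasoning

    ≥√-* : ∀ a b X Y → N * (X * X) ≤ a * a → N * (Y * Y) ≤ b * b → N * X * Y ≤ a * b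
    ≥√-* a b X Y X√N≤a Y√N≤b = m*m≤n*n⇒m≤n (begin
      (N * X * Y) * (N * X * Y)         ≡⟨ N-square-* N X Y ⟩
      (N * (X * X)) * (N * (Y * Y))     ≤⟨ *-mono-≤ X√N≤a Y√N≤b ⟩
      (a * a) * (b * b)                 ≡⟨ square-* a b ⟨
      (a * b) * (a * b)                 ∎)
      where open ≤-Reasoning

    ≤√-+ : ∀ a b X Y → a * a ≤ N * (X * X) → b * b ≤ N * (Y * Y) →
           (a + b) * (a + b) ≤ N * ((X + Y) * (X + Y))
    ≤√-+ a b X Y a≤X√N b≤Y√N = begin
      (a + b) * (a + b)                                  ≡⟨ square-+ a b ⟩
      a * a + 2 * (a * b) + b * b                        ≤⟨ +-mono-≤ (+-mono-≤ a≤X√N (*-monoʳ-≤ 2 (≤√-* a b X Y a≤X√N b≤Y√N))) b≤Y√N ⟩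
      N * (X * X) + 2 * (N * X * Y) + N * (Y * Y)        ≡⟨ N-square-+ N X Y ⟨
      N * ((X + Y) * (X + Y))                            ∎
      where open ≤-Reasoning

    >√-+ : ∀ a b X Y → N * (X * X) < a * a → N * (Y * Y) ≤ b * b →
           N * ((X + Y) * (X + Y)) < (a + b) * (a + b)
    >√-+ a b X Y X√N<a Y√N≤b = begin-strict
      N * ((X + Y) * (X + Y))                            ≡⟨ N-square-+ N X Y ⟩
      N * (X * X) + 2 * (N * X * Y) + N * (Y * Y)        <⟨ +-mono-<-≤ (+-mono-<-≤ X√N<a (*-monoʳ-≤ 2 (≥√-* a b X Y (<⇒≤ X√N<a) Y√N≤b))) Y√N≤b ⟩
      a * a + 2 * (a * b) + b * b                        ≡⟨ square-+ a b ⟨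
      (a + b) * (a + b)                                  ∎
      where open ≤-Reasoning

    ⌊_·√N⌋ : ℕ → ℕ
    ⌊ X ·√N⌋ = ⌊√ N * (X * X) ⌋

    ⌊·√N⌋-mono-≤ : ∀ X Y → X ≤ Y → ⌊ X ·√N⌋ ≤ ⌊ Y ·√N⌋
    ⌊·√N⌋-mono-≤ X Y X≤Y = m*m≤n⇒m≤⌊√n⌋ ⌊ X ·√N⌋ (N * (Y * Y)) (≤-trans (⌊√n⌋²≤n (N * (X * X))) (*-monoʳ-≤ N (m≤n⇒m*m≤n*n X≤Y)))

    -- a = ⌊(X + Y)√N⌋ - ⌊X√N⌋ is within one of Y√N (stated after squaring).
    ⌊·√N⌋-+-bounds : ∀ X Y a → ⌊ X + Y ·√N⌋ ≡ ⌊ X ·√N⌋ + a →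
                     a * a ≤ N * (Y * Y) + 2 * a × N * (Y * Y) ≤ a * a + 2 * a
    ⌊·√N⌋-+-bounds X Y a F+a = upper a F+a , lower
      where
      F F′ : ℕ
      F = ⌊ X ·√N⌋
      F′ = ⌊ X + Y ·√N⌋

      square-suc : ∀ a → suc a * suc a ≡ suc (a * a + 2 * a)
      square-suc = solve-∀

      upper : ∀ a → F′ ≡ F + a → a * a ≤ N * (Y * Y) + 2 * a
      upper zero _ = z≤n
      upper (suc a) F′≡F+1+a with N * (Y * Y) ≤? a * a
      ... | yes Y√N≤a = ⊥-elim (<⇒≱ too-big (⌊√n⌋²≤n (N * ((X + Y) * (X + Y)))))
        where
        too-big : N * ((X + Y) * (X + Y)) < F′ * F′
        too-big = subst (λ c → N * ((X + Y) * (X + Y)) < c * c) (trans (sym (+-suc F a)) (sym F′≡F+1+a))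
                    (>√-+ (suc F) a X Y (n<[1+⌊√n⌋]² (N * (X * X))) Y√N≤a)
      ... | no Y√N≰a = begin
        suc a * suc a                 ≡⟨ square-suc a ⟩
        suc (a * a + 2 * a)           ≤⟨ +-monoˡ-≤ (2 * a) (≰⇒> Y√N≰a) ⟩
        N * (Y * Y) + 2 * a           ≤⟨ +-monoʳ-≤ (N * (Y * Y)) (*-monoʳ-≤ 2 (n≤1+n a)) ⟩
        N * (Y * Y) + 2 * suc a       ∎
        where open ≤-Reasoning

      lower : N * (Y * Y) ≤ a * a + 2 * a
      lower with suc a * suc a ≤? N * (Y * Y)
      ... | yes 1+a≤Y√N = ⊥-elim (<⇒≱ (n<[1+⌊√n⌋]² (N * ((X + Y) * (X + Y)))) too-small)
        where
        too-small : suc F′ * suc F′ ≤ N * ((X + Y) * (X + Y))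
        too-small = subst (λ c → c * c ≤ N * ((X + Y) * (X + Y))) (trans (+-suc F a) (cong suc (sym F+a)))
                      (≤√-+ F (suc a) X Y (⌊√n⌋²≤n (N * (X * X))) 1+a≤Y√N)
      ... | no 1+a≰Y√N = ≤-pred (subst (N * (Y * Y) <_) (square-suc a) (≰⇒> 1+a≰Y√N))

    record Approximation (B : ℕ) : Set where
      field
        p q : ℕ
        0<q : 0 < q
        q≤B : q ≤ B
        Bp²≤BNq²+2p : B * (p * p) ≤ B * (N * (q * q)) + 2 * p
        BNq²≤Bp²+2p : B * (N * (q * q)) ≤ B * (p * p) + 2 * p

    module _ (B : ℕ) .{{_ : NonZero B}} where

      private

        B*⌊q√N⌋≤⌊Bq√N⌋ : ∀ q → B * ⌊ q ·√N⌋ ≤ ⌊ B * q ·√N⌋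
        B*⌊q√N⌋≤⌊Bq√N⌋ q = m*m≤n⇒m≤⌊√n⌋ (B * ⌊ q ·√N⌋) (N * ((B * q) * (B * q))) (begin
          (B * f) * (B * f)            ≡⟨ square-*ˡ B f ⟩
          B * B * (f * f)              ≤⟨ *-monoʳ-≤ (B * B) (⌊√n⌋²≤n (N * (q * q))) ⟩
          B * B * (N * (q * q))        ≡⟨ rescale N B q ⟨
          N * ((B * q) * (B * q))      ∎)
          where
          open ≤-Reasoning
          f : ℕ
          f = ⌊ q ·√N⌋

        ⌊Bq√N⌋<B*suc⌊q√N⌋ : ∀ q → ⌊ B * q ·√N⌋ < B * suc ⌊ q ·√N⌋
        ⌊Bq√N⌋<B*suc⌊q√N⌋ q = n<m*m⇒⌊√n⌋<m (B * suc ⌊ q ·√N⌋) (N * ((B * q) * (B * q))) (begin-strict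
          N * ((B * q) * (B * q))           ≡⟨ rescale N B q ⟩
          B * B * (N * (q * q))             <⟨ *-monoʳ-< (B * B) {{m*n≢0 B B}} (n<[1+⌊√n⌋]² (N * (q * q))) ⟩
          B * B * (suc f * suc f)           ≡⟨ square-*ˡ B (suc f) ⟨
          (B * suc f) * (B * suc f)         ∎)
          where
          open ≤-Reasoning
          f : ℕ
          f = ⌊ q ·√N⌋

        digit : ℕ → ℕ
        digit q = ⌊ B * q ·√N⌋ ∸ B * ⌊ q ·√N⌋

        digit< : ∀ q → digit q < B
        digit< q = m<n+o⇒m∸n<o ⌊ B * q ·√N⌋ (B * ⌊ q ·√N⌋)
                     (subst (⌊ B * q ·√N⌋ <_) (trans (*-suc B _) (+-comm B _)) (⌊Bq√N⌋<B*suc⌊q√N⌋ q))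

        ⌊Bq√N⌋≡ : ∀ q → ⌊ B * q ·√N⌋ ≡ B * ⌊ q ·√N⌋ + digit q
        ⌊Bq√N⌋≡ q = sym (m+[n∸m]≡n (B*⌊q√N⌋≤⌊Bq√N⌋ q))

        digitFin : Fin (suc B) → Fin B
        digitFin i = fromℕ< (digit< (toℕ i))

      -- Pigeonhole on the first base-B digit of the fractional part of q√N, 0 ≤ q ≤ B.
      dirichlet : Approximation B
      dirichlet = from-collision (pigeonhole (n<1+n B) digitFin)
        where
        from-collision : (∃₂ λ i j → i Fin.< j × digitFin i ≡ digitFin j) → Approximation B
        from-collision (i , j , i<j , same-digit) = record
          { p = p ; q = q ; 0<q = m<n⇒0<n∸m i<j ; q≤B = q≤B
          ; Bp²≤BNq²+2p = cancel upper ; BNq²≤Bp²+2p = cancel lower }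
          where
          q₁ q₂ q p : ℕ
          q₁ = toℕ i
          q₂ = toℕ j
          q = q₂ ∸ q₁
          p = ⌊ q₂ ·√N⌋ ∸ ⌊ q₁ ·√N⌋

          q≤B : q ≤ B
          q≤B = ≤-trans (m∸n≤m q₂ q₁) (≤-pred (toℕ<n j))

          q₂≡q₁+q : B * q₁ + B * q ≡ B * q₂
          q₂≡q₁+q = trans (sym (*-distribˡ-+ B q₁ q)) (cong (B *_) (m+[n∸m]≡n (<⇒≤ i<j)))

          ⌊q₂√N⌋≡ : ⌊ q₂ ·√N⌋ ≡ ⌊ q₁ ·√N⌋ + p
          ⌊q₂√N⌋≡ = sym (m+[n∸m]≡n (⌊·√N⌋-mono-≤ q₁ q₂ (<⇒≤ i<j)))

          digits≡ : digit q₁ ≡ digit q₂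
          digits≡ = fromℕ<-injective (digit q₁) (digit q₂) (digit< q₁) (digit< q₂) same-digit

          step : ⌊ B * q₁ + B * q ·√N⌋ ≡ ⌊ B * q₁ ·√N⌋ + B * p
          step = begin
            ⌊ B * q₁ + B * q ·√N⌋                     ≡⟨ cong ⌊_·√N⌋ q₂≡q₁+q ⟩
            ⌊ B * q₂ ·√N⌋                             ≡⟨ ⌊Bq√N⌋≡ q₂ ⟩
            B * ⌊ q₂ ·√N⌋ + digit q₂                  ≡⟨ cong₂ (λ f d → B * f + d) ⌊q₂√N⌋≡ (sym digits≡) ⟩
            B * (⌊ q₁ ·√N⌋ + p) + digit q₁            ≡⟨ regroup B ⌊ q₁ ·√N⌋ p (digit q₁) ⟩
            (B * ⌊ q₁ ·√N⌋ + digit q₁) + B * p        ≡⟨ cong (_+ B * p) (⌊Bq√N⌋≡ q₁) ⟨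
            ⌊ B * q₁ ·√N⌋ + B * p                     ∎
            where
            open ≡-Reasoning
            regroup : ∀ B f p d → B * (f + p) + d ≡ (B * f + d) + B * p
            regroup = solve-∀

          bounds : (B * p) * (B * p) ≤ N * ((B * q) * (B * q)) + 2 * (B * p) ×
                   N * ((B * q) * (B * q)) ≤ (B * p) * (B * p) + 2 * (B * p)
          bounds = ⌊·√N⌋-+-bounds (B * q₁) (B * q) (B * p) step

          upper : B * (B * (p * p)) ≤ B * (B * (N * (q * q)) + 2 * p)
          upper = subst₂ _≤_ (e₁ B p) (e₂ B N p q) (proj₁ bounds)
            where
            e₁ : ∀ B p → (B * p) * (B * p) ≡ B * (B * (p * p))
            e₁ = solve-∀
            e₂ : ∀ B N p q → N * ((B * q) * (B * q)) + 2 * (B * p) ≡ B * (B * (N * (q * q)) + 2 * p)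
            e₂ = solve-∀

          lower : B * (B * (N * (q * q))) ≤ B * (B * (p * p) + 2 * p)
          lower = subst₂ _≤_ (e₁ B N q) (e₂ B p) (proj₂ bounds)
            where
            e₁ : ∀ B N q → N * ((B * q) * (B * q)) ≡ B * (B * (N * (q * q)))
            e₁ = solve-∀
            e₂ : ∀ B p → (B * p) * (B * p) + 2 * (B * p) ≡ B * (B * (p * p) + 2 * p)
            e₂ = solve-∀

          cancel : ∀ {m n} → B * m ≤ B * n → m ≤ n
          cancel {m} {n} = *-cancelˡ-≤ {m} {n} B

module CongruentSolutions where

  open import Data.Integer hiding (_/_; _%_)
  open import Data.Integer.Properties
  open import Data.Integer.Divisibility.Signed using (_∣_; divides)
  open import Data.Integer.Tactic.RingSolver using (solve-∀)
  open import Data.Nat as ℕ using (ℕ)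
  import Data.Nat.Properties as ℕ
  open import Data.Nat.DivMod using (_%_; _/_; m≡m%n+[m/n]*n)
  open import Data.Product using (∃₂; _×_; _,_; proj₁; proj₂)
  open import Relation.Nullary using (¬_)
  open import Relation.Binary.PropositionalEquality

  open Cast using (‵_; □_; _⊕_; _⊗_; pos-⟦⟧)
  open Dirichlet using (m*m≤n*n⇒m≤n)

  brahmagupta : ∀ N P Q P′ Q′ →
    (P * P′ - N * Q * Q′) * (P * P′ - N * Q * Q′) - N * ((P * Q′ - P′ * Q) * (P * Q′ - P′ * Q))
      ≡ (P * P - N * (Q * Q)) * (P′ * P′ - N * (Q′ * Q′))
  brahmagupta = solve-∀

  i-j≡k⇒i≡j+k : ∀ i j k → i - j ≡ k → i ≡ j + k
  i-j≡k⇒i≡j+k i j k i-j≡k = trans (lemma i j) (cong (λ r → j + r) i-j≡k)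
    where
    lemma : ∀ i j → i ≡ j + (i - j)
    lemma = solve-∀

  +-cancelʳ-≡ : ∀ k i j → i + k ≡ j + k → i ≡ j
  +-cancelʳ-≡ k i j i+k≡j+k = trans (lemma i k) (trans (cong (_- k) i+k≡j+k) (sym (lemma j k)))
    where
    lemma : ∀ i k → i ≡ i + k - k
    lemma = solve-∀

  -- (P - Q√N) (P′ + Q′√N) / k = x + y√N is integral because the two solutions are congruent modulo k.
  pell-from-congruent-solutions :
    ∀ N P Q P′ Q′ → let k = P * P - N * (Q * Q) in .{{NonZero k}} →
    P′ * P′ - N * (Q′ * Q′) ≡ k → k ∣ P′ - P → k ∣ Q′ - Q →
    ∃₂ λ x y → x * x ≡ 1ℤ + N * (y * y) × (y ≡ 0ℤ → Q′ * Q′ ≡ Q * Q × P * Q′ ≡ P′ * Q)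
  pell-from-congruent-solutions N P Q P′ Q′ k′≡k (divides α P′-P≡αk) (divides β Q′-Q≡βk) =
    x , y , x²≡1+Ny² , proportional
    where
    k = P * P - N * (Q * Q)
    x = 1ℤ + P * α - N * Q * β
    y = P * β - Q * α

    P′≡ : P′ ≡ P + α * k
    P′≡ = i-j≡k⇒i≡j+k P′ P (α * k) P′-P≡αk

    Q′≡ : Q′ ≡ Q + β * k
    Q′≡ = i-j≡k⇒i≡j+k Q′ Q (β * k) Q′-Q≡βk

    kx≡ : k * x ≡ P * P′ - N * Q * Q′
    kx≡ = trans (expand N P Q α β) (sym (cong₂ (λ u v → P * u - N * Q * v) P′≡ Q′≡))
      where
      expand : ∀ N P Q α β → let k = P * P - N * (Q * Q) in
               k * (1ℤ + P * α - N * Q * β) ≡ P * (P + α * k) - N * Q * (Q + β * k)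
      expand = solve-∀

    ky≡ : k * y ≡ P * Q′ - P′ * Q
    ky≡ = trans (expand N P Q α β) (sym (cong₂ (λ u v → P * v - u * Q) P′≡ Q′≡))
      where
      expand : ∀ N P Q α β → let k = P * P - N * (Q * Q) in
               k * (P * β - Q * α) ≡ P * (Q + β * k) - (P + α * k) * Q
      expand = solve-∀

    instance
      k²≢0 : NonZero (k * k)
      k²≢0 = i*j≢0 k k

    x²≡1+Ny² : x * x ≡ 1ℤ + N * (y * y)
    x²≡1+Ny² = trans (i-j≡k⇒i≡j+k (x * x) (N * (y * y)) 1ℤ (*-cancelˡ-≡ (k * k) _ _ (begin
      (k * k) * (x * x - N * (y * y))                    ≡⟨ scale k x y N ⟩
      (k * x) * (k * x) - N * ((k * y) * (k * y))        ≡⟨ cong₂ (λ u v → u * u - N * (v * v)) kx≡ ky≡ ⟩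
      (P * P′ - N * Q * Q′) * (P * P′ - N * Q * Q′) - N * ((P * Q′ - P′ * Q) * (P * Q′ - P′ * Q))
                                                         ≡⟨ brahmagupta N P Q P′ Q′ ⟩
      k * (P′ * P′ - N * (Q′ * Q′))                      ≡⟨ cong (k *_) k′≡k ⟩
      k * k                                              ≡⟨ *-identityʳ (k * k) ⟨
      (k * k) * 1ℤ                                       ∎)))
      (+-comm (N * (y * y)) 1ℤ)
      where
      open ≡-Reasoning
      scale : ∀ k x y N → (k * k) * (x * x - N * (y * y)) ≡ (k * x) * (k * x) - N * ((k * y) * (k * y))
      scale = solve-∀

    proportional : y ≡ 0ℤ → Q′ * Q′ ≡ Q * Q × P * Q′ ≡ P′ * Q
    proportional y≡0 = i-j≡0⇒i≡j _ _ (*-cancelˡ-≡ k _ _ k[Q′²-Q²]≡0) , i-j≡0⇒i≡j _ _ PQ′-P′Q≡0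
      where
      open ≡-Reasoning
      PQ′-P′Q≡0 : P * Q′ - P′ * Q ≡ 0ℤ
      PQ′-P′Q≡0 = trans (sym ky≡) (trans (cong (k *_) y≡0) (*-zeroʳ k))

      factor : ∀ N P Q P′ Q′ → (P * P - N * (Q * Q)) * (Q′ * Q′ - Q * Q)
               ≡ (P * Q′ - P′ * Q) * (P * Q′ + P′ * Q) + Q * Q * ((P′ * P′ - N * (Q′ * Q′)) - (P * P - N * (Q * Q)))
      factor = solve-∀

      k[Q′²-Q²]≡0 : k * (Q′ * Q′ - Q * Q) ≡ k * 0ℤ
      k[Q′²-Q²]≡0 = begin
        k * (Q′ * Q′ - Q * Q)                                          ≡⟨ factor N P Q P′ Q′ ⟩
        (P * Q′ - P′ * Q) * (P * Q′ + P′ * Q) + Q * Q * ((P′ * P′ - N * (Q′ * Q′)) - k)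
                                                                       ≡⟨ cong₂ (λ u v → u * (P * Q′ + P′ * Q) + Q * Q * (v - k)) PQ′-P′Q≡0 k′≡k ⟩
        0ℤ * (P * Q′ + P′ * Q) + Q * Q * (k - k)                       ≡⟨ vanish (P * Q′ + P′ * Q) (Q * Q) k ⟩
        k * 0ℤ                                                         ∎
        where
        vanish : ∀ a b k → 0ℤ * a + b * (k - k) ≡ k * 0ℤ
        vanish = solve-∀

  %≡%⇒∣- : ∀ a b W .{{_ : ℕ.NonZero W}} → a % W ≡ b % W → + W ∣ + b - + a
  %≡%⇒∣- a b W a%W≡b%W = divides (+ (b / W) - + (a / W)) (begin
    + b - + a                                                 ≡⟨ cong₂ (λ u v → + u - + v) (m≡m%n+[m/n]*n b W) (m≡m%n+[m/n]*n a W) ⟩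
    + (b % W ℕ.+ b / W ℕ.* W) - + (a % W ℕ.+ a / W ℕ.* W)    ≡⟨ cong₂ _-_ (cast (b % W) (b / W)) (cast (a % W) (a / W)) ⟩
    (+ (b % W) + + (b / W) * + W) - (+ (a % W) + + (a / W) * + W)
                                                              ≡⟨ cong (λ r → (r + + (b / W) * + W) - (+ (a % W) + + (a / W) * + W)) (cong +_ (sym a%W≡b%W)) ⟩
    (+ (a % W) + + (b / W) * + W) - (+ (a % W) + + (a / W) * + W)
                                                              ≡⟨ cancel (+ (a % W)) (+ (b / W)) (+ (a / W)) (+ W) ⟩
    (+ (b / W) - + (a / W)) * + W                             ∎)
    where
    open ≡-Reasoning
    cast : ∀ r q → + (r ℕ.+ q ℕ.* W) ≡ + r + + q * + W
    cast r q = trans (pos-+ r (q ℕ.* W)) (cong (λ s → + r + s) (pos-* q W))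
    cancel : ∀ r b a W → (r + b * W) - (r + a * W) ≡ (b - a) * W
    cancel = solve-∀

  private
    norm-cast : ∀ N p q → + p * + p - + N * (+ q * + q) ≡ p ℕ.* p ⊖ N ℕ.* (q ℕ.* q)
    norm-cast N p q = trans (cong₂ (λ u v → u - + N * v) (sym (pos-* p p)) (sym (pos-* q q)))
                        (trans (cong (λ v → + (p ℕ.* p) - v) (sym (pos-* N (q ℕ.* q)))) (m-n≡m⊖n (p ℕ.* p) (N ℕ.* (q ℕ.* q))))

    m*m≡n*n⇒m≡n : ∀ m n → m ℕ.* m ≡ n ℕ.* n → m ≡ n
    m*m≡n*n⇒m≡n m n m²≡n² = ℕ.≤-antisym (m*m≤n*n⇒m≤n (ℕ.≤-reflexive m²≡n²)) (m*m≤n*n⇒m≤n (ℕ.≤-reflexive (sym m²≡n²)))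

  pell-from-congruent-pair :
    ∀ N p q p′ q′ → let k = p ℕ.* p ⊖ N ℕ.* (q ℕ.* q) in
    0 ℕ.< q → k ≢ 0ℤ → p′ ℕ.* p′ ⊖ N ℕ.* (q′ ℕ.* q′) ≡ k → k ∣ + p′ - + p → k ∣ + q′ - + q →
    ¬ (p ≡ p′ × q ≡ q′) → ∃₂ λ x y → 0 ℕ.< y × x ℕ.* x ≡ N ℕ.* (y ℕ.* y) ℕ.+ 1
  pell-from-congruent-pair N p q p′ q′ 0<q k≢0 k′≡k k∣p′-p k∣q′-q distinct =
    from-solution (pell-from-congruent-solutions (+ N) (+ p) (+ q) (+ p′) (+ q′)
      (trans (norm-cast N p′ q′) (trans k′≡k (sym k≡))) (subst (_∣ + p′ - + p) (sym k≡) k∣p′-p) (subst (_∣ + q′ - + q) (sym k≡) k∣q′-q))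
    where
    k≡ : + p * + p - + N * (+ q * + q) ≡ p ℕ.* p ⊖ N ℕ.* (q ℕ.* q)
    k≡ = norm-cast N p q

    instance
      k≢0′ : NonZero (+ p * + p - + N * (+ q * + q))
      k≢0′ = ≢-nonZero (λ k≡0 → k≢0 (trans (sym k≡) k≡0))

    from-solution : (∃₂ λ x y → x * x ≡ 1ℤ + + N * (y * y) × (y ≡ 0ℤ → + q′ * + q′ ≡ + q * + q × + p * + q′ ≡ + p′ * + q)) →
                    ∃₂ λ x y → 0 ℕ.< y × x ℕ.* x ≡ N ℕ.* (y ℕ.* y) ℕ.+ 1
    from-solution (x , y , x²≡1+Ny² , proportional) = ∣ x ∣ , ∣ y ∣ , ℕ.n≢0⇒n>0 ∣y∣≢0 , +-injective pell
      where
      ∣y∣≢0 : ∣ y ∣ ≢ 0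
      ∣y∣≢0 ∣y∣≡0 = distinct (p≡p′ , q≡q′)
        where
        q′²≡q² : + q′ * + q′ ≡ + q * + q
        q′²≡q² = proj₁ (proportional (∣i∣≡0⇒i≡0 ∣y∣≡0))
        pq′≡p′q : + p * + q′ ≡ + p′ * + q
        pq′≡p′q = proj₂ (proportional (∣i∣≡0⇒i≡0 ∣y∣≡0))
        q≡q′ : q ≡ q′
        q≡q′ = m*m≡n*n⇒m≡n q q′ (sym (+-injective (trans (pos-* q′ q′) (trans q′²≡q² (sym (pos-* q q))))))
        p≡p′ : p ≡ p′
        p≡p′ = ℕ.*-cancelʳ-≡ p p′ q {{ℕ.>-nonZero 0<q}}
                 (trans (cong (p ℕ.*_) q≡q′) (+-injective (trans (pos-* p q′) (trans pq′≡p′q (sym (pos-* p′ q))))))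
      pell : + (∣ x ∣ ℕ.* ∣ x ∣) ≡ + (N ℕ.* (∣ y ∣ ℕ.* ∣ y ∣) ℕ.+ 1)
      pell = trans (pos-⟦⟧ (□ x)) (trans x²≡1+Ny² (trans (+-comm 1ℤ (+ N * (y * y))) (sym (pos-⟦⟧ (‵ N ⊗ □ y ⊕ ‵ 1)))))

module Pell where

  open import Data.Nat
  open import Data.Nat.Properties
  open import Data.Nat.DivMod using (_%_; m%n<n)
  open import Data.Nat.Divisibility using (_∣_; ∣-trans; m≤n⇒m!∣n!; m∣m*n)
  open import Data.Nat.Tactic.RingSolver using (solve-∀)
  open import Data.Integer as ℤ using (ℤ; +_; _⊖_; ∣_∣; 0ℤ)
  import Data.Integer.Properties as ℤ
  import Data.Integer.Divisibility.Signed as ℤ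
  open import Data.Empty using (⊥-elim)
  open import Data.Sum using ([_,_]′)
  open import Data.Fin as Fin using (Fin; toℕ; fromℕ<; combine)
  open import Data.Fin.Properties using (pigeonhole; fromℕ<-injective; combine-injective)
  open import Data.Product using (∃₂; _×_; _,_; proj₁; proj₂)
  open import Relation.Binary.Definitions using (Tri; tri<; tri≈; tri>)
  open import Relation.Binary.PropositionalEquality

  open Dirichlet
  open CongruentSolutions hiding (+-cancelʳ-≡)

  B*y≤B*x+c⇒x<y⇒B≤c : ∀ B x y c → B * y ≤ B * x + c → x < y → B ≤ c
  B*y≤B*x+c⇒x<y⇒B≤c B x y c By≤Bx+c x<y = +-cancelʳ-≤ (B * x) B c (begin
    B + B * x       ≡⟨ *-suc B x ⟨
    B * suc x       ≤⟨ *-monoʳ-≤ B x<y ⟩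
    B * y           ≤⟨ By≤Bx+c ⟩
    B * x + c       ≡⟨ +-comm (B * x) c ⟩
    c + B * x       ∎)
    where open ≤-Reasoning

  ∣m⊖n∣≤o : ∀ m n o → m ≤ n + o → n ≤ m + o → ∣ m ⊖ n ∣ ≤ o
  ∣m⊖n∣≤o m n o m≤n+o n≤m+o = [ (λ m≤n → bound m n o m≤n n≤m+o) , (λ n≤m → subst (_≤ o) (ℤ.∣m⊖n∣≡∣n⊖m∣ n m) (bound n m o n≤m m≤n+o)) ]′ (≤-total m n)
    where
    bound : ∀ m n o → m ≤ n → n ≤ m + o → ∣ m ⊖ n ∣ ≤ o
    bound m n o m≤n n≤m+o = subst (_≤ o) (sym (ℤ.∣⊖∣-≤ m≤n)) (subst (n ∸ m ≤_) (m+n∸m≡n m o) (∸-monoˡ-≤ m n≤m+o))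

  d∣n! : ∀ {d n} → 0 < d → d ≤ n → d ∣ n !
  d∣n! {suc d} _ d≤n = ∣-trans (m∣m*n (d !)) (m≤n⇒m!∣n! d≤n)

  module _ (N : ℕ) (N-nonsquare : ∀ p q → 0 < q → p * p ≢ N * (q * q)) where

    r : ℕ
    r = ⌊√ N ⌋

    K : ℕ
    K = 2 * suc (suc r)

    p≤[1+r]q+1 : ∀ p q → 0 < q → p * p ≤ N * (q * q) + 2 * p → p ≤ suc r * q + 1
    p≤[1+r]q+1 zero q _ _ = z≤n
    p≤[1+r]q+1 (suc m) q@(suc _) _ [1+m]²≤Nq²+2+2m = subst (suc m ≤_) (+-comm 1 (suc r * q)) (s≤s m≤[1+r]q)
      where
      shift : ∀ X m → X + 2 * suc m ≡ (X + 1) + (2 * m + 1)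
      shift = solve-∀
      square-suc : ∀ m → suc m * suc m ≡ m * m + (2 * m + 1)
      square-suc = solve-∀
      rescale : ∀ a q → a * a * (q * q) ≡ (a * q) * (a * q)
      rescale = solve-∀

      m²≤Nq²+1 : m * m ≤ N * (q * q) + 1
      m²≤Nq²+1 = +-cancelʳ-≤ (2 * m + 1) (m * m) (N * (q * q) + 1)
                   (subst₂ _≤_ (square-suc m) (shift (N * (q * q)) m) [1+m]²≤Nq²+2+2m)

      Nq²<[1+r]²q² : N * (q * q) < suc r * suc r * (q * q)
      Nq²<[1+r]²q² = *-monoˡ-< (q * q) (n<[1+⌊√n⌋]² N)

      m≤[1+r]q : m ≤ suc r * q
      m≤[1+r]q = m*m≤n*n⇒m≤n (≤-trans m²≤Nq²+1
                   (subst (N * (q * q) + 1 ≤_) (rescale (suc r) q) (subst (_≤ suc r * suc r * (q * q)) (+-comm 1 _) Nq²<[1+r]²q²)))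

    module _ {B : ℕ} .{{_ : NonZero B}} (a : Approximation N B) where
      open Approximation a

      2p≤BK : 2 * p ≤ B * K
      2p≤BK = begin
        2 * p                            ≤⟨ *-monoʳ-≤ 2 (p≤[1+r]q+1 p q 0<q p²≤Nq²+2p) ⟩
        2 * (suc r * q + 1)              ≤⟨ *-monoʳ-≤ 2 (+-monoˡ-≤ 1 (*-monoʳ-≤ (suc r) q≤B)) ⟩
        2 * (suc r * B + 1)              ≤⟨ *-monoʳ-≤ 2 (+-monoʳ-≤ (suc r * B) (>-nonZero⁻¹ B)) ⟩
        2 * (suc r * B + B)              ≡⟨ regroup B r ⟩
        B * K                            ∎
        where
        open ≤-Reasoning
        regroup : ∀ B r → 2 * (suc r * B + B) ≡ B * (2 * suc (suc r))
        regroup = solve-∀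
        p²≤Nq²+2p : p * p ≤ N * (q * q) + 2 * p
        p²≤Nq²+2p = *-cancelˡ-≤ B (begin
          B * (p * p)                    ≤⟨ Bp²≤BNq²+2p ⟩
          B * (N * (q * q)) + 2 * p      ≤⟨ +-monoʳ-≤ (B * (N * (q * q))) (m≤n*m (2 * p) B) ⟩
          B * (N * (q * q)) + B * (2 * p) ≡⟨ *-distribˡ-+ B (N * (q * q)) (2 * p) ⟨
          B * (N * (q * q) + 2 * p)      ∎)

      -- With q ≤ B, the Dirichlet bound B |p² - N q²| ≤ 2p gives |p² - N q²| ≤ K.
      p²≤Nq²+K : p * p ≤ N * (q * q) + K
      p²≤Nq²+K = *-cancelˡ-≤ B (begin
        B * (p * p)                      ≤⟨ Bp²≤BNq²+2p ⟩
        B * (N * (q * q)) + 2 * p        ≤⟨ +-monoʳ-≤ (B * (N * (q * q))) 2p≤BK ⟩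
        B * (N * (q * q)) + B * K        ≡⟨ *-distribˡ-+ B (N * (q * q)) K ⟨
        B * (N * (q * q) + K)            ∎)
        where open ≤-Reasoning

      Nq²≤p²+K : N * (q * q) ≤ p * p + K
      Nq²≤p²+K = *-cancelˡ-≤ B (begin
        B * (N * (q * q))                ≤⟨ BNq²≤Bp²+2p ⟩
        B * (p * p) + 2 * p              ≤⟨ +-monoʳ-≤ (B * (p * p)) 2p≤BK ⟩
        B * (p * p) + B * K              ≡⟨ *-distribˡ-+ B (p * p) K ⟨
        B * (p * p + K)                  ∎)
        where open ≤-Reasoning

      B≤2p : B ≤ 2 * p
      B≤2p = by-cases (<-cmp (p * p) (N * (q * q)))
        where
        by-cases : Tri (p * p < N * (q * q)) (p * p ≡ N * (q * q)) (N * (q * q) < p * p) → B ≤ 2 * p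
        by-cases (tri< p²<Nq² _ _) = B*y≤B*x+c⇒x<y⇒B≤c B (p * p) (N * (q * q)) (2 * p) BNq²≤Bp²+2p p²<Nq²
        by-cases (tri≈ _ p²≡Nq² _) = ⊥-elim (N-nonsquare p q 0<q p²≡Nq²)
        by-cases (tri> _ _ Nq²<p²) = B*y≤B*x+c⇒x<y⇒B≤c B (N * (q * q)) (p * p) (2 * p) Bp²≤BNq²+2p Nq²<p²

    -- The j-th approximation has denominator bound suc (D j), chosen larger than every earlier 2p.
    D : ℕ → ℕ
    approx : ∀ j → Approximation N (suc (D j))
    D zero = 0
    D (suc j) = D j + 2 * Approximation.p (approx j)
    approx j = dirichlet N (suc (D j))

    p q : ℕ → ℕ
    p j = Approximation.p (approx j)
    q j = Approximation.q (approx j)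

    D-mono : ∀ {i j} → i ≤′ j → D i ≤ D j
    D-mono ≤′-refl = ≤-refl
    D-mono {i} {suc j} (≤′-step i≤′j) = ≤-trans (D-mono i≤′j) (m≤m+n (D j) (2 * p j))

    p-mono-< : ∀ {i j} → i < j → p i < p j
    p-mono-< {i} {j} i<j = *-cancelˡ-< 2 (p i) (p j) (begin-strict
      2 * p i            ≤⟨ m≤n+m (2 * p i) (D i) ⟩
      D (suc i)          ≤⟨ D-mono (≤⇒≤′ i<j) ⟩
      D j                <⟨ n<1+n (D j) ⟩
      suc (D j)          ≤⟨ B≤2p (approx j) ⟩
      2 * p j            ∎)
      where open ≤-Reasoning

    norm : ℕ → ℤ
    norm j = p j * p j ⊖ N * (q j * q j)

    shift : ℕ → ℕ
    shift j = (p j * p j + K) ∸ N * (q j * q j)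

    norm+K≡shift : ∀ j → norm j ℤ.+ + K ≡ + shift j
    norm+K≡shift j = trans (ℤ.distribˡ-⊖-+-pos K (p j * p j) (N * (q j * q j))) (ℤ.⊖-≥ (Nq²≤p²+K (approx j)))

    shift<1+2K : ∀ j → shift j < suc (2 * K)
    shift<1+2K j = s≤s (begin
      (p j * p j + K) ∸ N * (q j * q j)            ≤⟨ ∸-monoˡ-≤ (N * (q j * q j)) (+-monoˡ-≤ K (p²≤Nq²+K (approx j))) ⟩
      (N * (q j * q j) + K + K) ∸ N * (q j * q j)  ≡⟨ cong (_∸ N * (q j * q j)) (+-assoc (N * (q j * q j)) K K) ⟩
      (N * (q j * q j) + (K + K)) ∸ N * (q j * q j) ≡⟨ m+n∸m≡n (N * (q j * q j)) (K + K) ⟩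
      K + K                                        ≡⟨ cong (λ k → K + k) (+-identityʳ K) ⟨
      2 * K                                        ∎)
      where open ≤-Reasoning

    ∣norm∣≤K : ∀ j → ∣ norm j ∣ ≤ K
    ∣norm∣≤K j = ∣m⊖n∣≤o (p j * p j) (N * (q j * q j)) K (p²≤Nq²+K (approx j)) (Nq²≤p²+K (approx j))

    norm≢0 : ∀ j → norm j ≢ 0ℤ
    norm≢0 j norm≡0 = N-nonsquare (p j) (q j) (Approximation.0<q (approx j))
      (ℤ.+-injective (ℤ.i-j≡0⇒i≡j _ _ (trans (ℤ.m-n≡m⊖n (p j * p j) (N * (q j * q j))) norm≡0)))

    W : ℕ
    W = K !

    instance
      W≢0 : NonZero W
      W≢0 = K !≢0

    -- norm j is determined by shift j, and every possible norm divides W.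
    Class : Set
    Class = Fin (suc (2 * K) * W * W)

    class : ℕ → Class
    class j = combine (combine (fromℕ< (shift<1+2K j)) (fromℕ< (m%n<n (p j) W))) (fromℕ< (m%n<n (q j) W))

    class-injective : ∀ i j → class i ≡ class j → shift i ≡ shift j × p i % W ≡ p j % W × q i % W ≡ q j % W
    class-injective i j same =
      let (first≡ , q≡) = combine-injective _ _ _ _ same
          (shift≡ , p≡) = combine-injective _ _ _ _ first≡
      in fromℕ<-injective _ _ (shift<1+2K i) (shift<1+2K j) shift≡ ,
         fromℕ<-injective _ _ (m%n<n (p i) W) (m%n<n (p j) W) p≡ ,
         fromℕ<-injective _ _ (m%n<n (q i) W) (m%n<n (q j) W) q≡

    norm∣-cong : ∀ j {a b} → a % W ≡ b % W → norm j ℤ.∣ + b ℤ.- + a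
    norm∣-cong j {a} {b} a≡b = ℤ.∣-trans ℤ.m∣∣m∣ (ℤ.∣-trans (ℤ.∣ᵤ⇒∣ ∣norm∣∣W) (%≡%⇒∣- a b W a≡b))
      where
      ∣norm∣∣W : ∣ norm j ∣ ∣ W
      ∣norm∣∣W = d∣n! (n≢0⇒n>0 (λ ∣norm∣≡0 → norm≢0 j (ℤ.∣i∣≡0⇒i≡0 ∣norm∣≡0))) (∣norm∣≤K j)

    pell : ∃₂ λ x y → 0 < y × x * x ≡ N * (y * y) + 1
    pell = from-collision (pigeonhole (n<1+n _) (λ t → class (toℕ t)))
      where
      from-collision : (∃₂ λ s t → s Fin.< t × class (toℕ s) ≡ class (toℕ t)) → ∃₂ λ x y → 0 < y × x * x ≡ N * (y * y) + 1
      from-collision (s , t , s<t , same) =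
        pell-from-congruent-pair N (p i) (q i) (p j) (q j) (Approximation.0<q (approx i)) (norm≢0 i)
          normⱼ≡normᵢ (norm∣-cong i (proj₁ (proj₂ congruent))) (norm∣-cong i (proj₂ (proj₂ congruent)))
          (λ (pᵢ≡pⱼ , _) → <⇒≢ (p-mono-< s<t) pᵢ≡pⱼ)
        where
        i j : ℕ
        i = toℕ s
        j = toℕ t
        congruent : shift i ≡ shift j × p i % W ≡ p j % W × q i % W ≡ q j % W
        congruent = class-injective i j same
        normⱼ≡normᵢ : norm j ≡ norm i
        normⱼ≡normᵢ = CongruentSolutions.+-cancelʳ-≡ (+ K) (norm j) (norm i)
          (trans (norm+K≡shift j) (trans (cong +_ (sym (proj₁ congruent))) (sym (norm+K≡shift i))))

module Nonsquare where

  open import Data.Nat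
  open import Data.Nat.Properties
  open import Data.Nat.Divisibility using (_∣_; divides)
  open import Data.Nat.Primality using (euclidsLemma; prime[2])
  open import Data.Nat.Induction using (<-rec)
  open import Data.Nat.Tactic.RingSolver using (solve-∀)
  open import Data.Sum using ([_,_]′)
  open import Relation.Nullary using (¬_)
  open import Data.Empty using (⊥; ⊥-elim)
  open import Relation.Binary.PropositionalEquality

  2∣m*m⇒2∣m : ∀ m → 2 ∣ m * m → 2 ∣ m
  2∣m*m⇒2∣m m 2∣m² = [ (λ 2∣m → 2∣m) , (λ 2∣m → 2∣m) ]′ (euclidsLemma m m prime[2] 2∣m²)

  ¬2∣m⇒¬2∣n⇒¬2∣m*n : ∀ m n → ¬ 2 ∣ m → ¬ 2 ∣ n → ¬ 2 ∣ m * n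
  ¬2∣m⇒¬2∣n⇒¬2∣m*n m n 2∤m 2∤n 2∣mn = [ 2∤m , 2∤n ]′ (euclidsLemma m n prime[2] 2∣mn)

  -- Infinite descent: from p² = 2 o q² both p and q are even, and halving them gives a smaller solution.
  p*p≢2*o*[q*q] : ∀ o → ¬ 2 ∣ o → ∀ q → 0 < q → ∀ p → p * p ≢ 2 * o * (q * q)
  p*p≢2*o*[q*q] o 2∤o = <-rec _ descent
    where
    regroup₁ : ∀ o q → 2 * o * (q * q) ≡ o * (q * q) * 2
    regroup₁ = solve-∀
    regroup₂ : ∀ a → 2 * (2 * (a * a)) ≡ a * 2 * (a * 2)
    regroup₂ = solve-∀
    regroup₃ : ∀ o b → o * (b * 2 * (b * 2)) ≡ 2 * (2 * o * (b * b))
    regroup₃ = solve-∀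

    descent : ∀ q → (∀ {q′} → q′ < q → 0 < q′ → ∀ p → p * p ≢ 2 * o * (q′ * q′)) →
              0 < q → ∀ p → p * p ≢ 2 * o * (q * q)
    descent q ih 0<q p p²≡2oq² = from-even-p (2∣m*m⇒2∣m p (divides (o * (q * q)) (trans p²≡2oq² (regroup₁ o q))))
      where
      from-even-p : 2 ∣ p → ⊥
      from-even-p (divides a p≡a2) = from-even-q (2∣m*m⇒2∣m q 2∣q²)
        where
        2a²≡oq² : 2 * (a * a) ≡ o * (q * q)
        2a²≡oq² = *-cancelˡ-≡ (2 * (a * a)) (o * (q * q)) 2
                    (trans (regroup₂ a) (trans (cong (λ x → x * x) (sym p≡a2)) (trans p²≡2oq² (*-assoc 2 o (q * q)))))
        2∣q² : 2 ∣ q * q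
        2∣q² = [ (λ 2∣o → ⊥-elim (2∤o 2∣o)) , (λ 2∣q² → 2∣q²) ]′
                 (euclidsLemma o (q * q) prime[2] (divides (a * a) (trans (sym 2a²≡oq²) (*-comm 2 (a * a)))))
        from-even-q : 2 ∣ q → ⊥
        from-even-q (divides b q≡b2) = ih b<q 0<b a a²≡2ob²
          where
          a²≡2ob² : a * a ≡ 2 * o * (b * b)
          a²≡2ob² = *-cancelˡ-≡ (a * a) (2 * o * (b * b)) 2 (trans 2a²≡oq² (trans (cong (λ y → o * (y * y)) q≡b2) (regroup₃ o b)))
          0<b : 0 < b
          0<b = n≢0⇒n>0 (λ b≡0 → <⇒≢ 0<q (sym (trans q≡b2 (cong (_* 2) b≡0))))
          b<q : b < q
          b<q = subst (b <_) (sym q≡b2) (m<m*n b 2 {{>-nonZero 0<b}} (s≤s (s≤s z≤n)))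

module Orbit where

  open import Data.Integer
  open import Data.Integer.Properties
  open import Data.Integer.Tactic.RingSolver using (solve-∀)
  open import Data.Nat as ℕ using (ℕ)
  import Data.Nat.Properties as ℕ
  open import Data.Nat.Divisibility using (divides; ∣m+n∣m⇒∣n; m∣m*n) renaming (_∣_ to _∣ℕ_)
  open import Data.Nat.DivMod using (m*n/n≡m)
  import Data.Nat.Tactic.RingSolver as ℕ-Solver
  open import Relation.Nullary using (¬_)
  open import Data.Product using (∃; ∃₂; _×_; _,_)
  open import Relation.Binary.PropositionalEquality

  open import Defs using (halfSqPlusOne)
  open Cast

  -- The quadratic form whose zeros (u, v) give solutions n = (A (u + v) - 2e) / 4, d₁ = A u, d₂ = A v.
  Φ : (m A e u v : ℤ) → ℤ
  Φ m A e u v = (A * (u + v) - + 2 * e) * (A * (u + v) - + 2 * e) + + 16 - + 32 * m * A * u * v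

  private
    -- With A = 8m - t, X = t (u + v) + 2e, D = v - u and N = 8mt, t Φ is an affine function of X² - N D².
    t*Φ≡ : ∀ m t e u v → t * ((((+ 8 * m - t) * (u + v) - + 2 * e) * ((+ 8 * m - t) * (u + v) - + 2 * e) + + 16 - + 32 * m * (+ 8 * m - t) * u * v))
         ≡ - (+ 8 * m - t) * ((t * (u + v) + + 2 * e) * (t * (u + v) + + 2 * e) - + 8 * m * t * ((v - u) * (v - u)))
           + + 4 * (+ 8 * m - t) * (e * e) + + 4 * t * (e * e + + 4)
    t*Φ≡ = solve-∀

    norm-* : ∀ N a b X D → (a * X + N * b * D) * (a * X + N * b * D) - N * ((b * X + a * D) * (b * X + a * D))
             ≡ (a * a - N * (b * b)) * (X * X - N * (D * D))
    norm-* = solve-∀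

  0<i*j⇒0<i+j⇒0<i : ∀ i j → 0ℤ < i * j → 0ℤ < i + j → 0ℤ < i
  0<i*j⇒0<i+j⇒0<i +[1+ n ] j _ _ = +<+ ℕ.z<s
  0<i*j⇒0<i+j⇒0<i (+ 0) j (+<+ ()) _
  0<i*j⇒0<i+j⇒0<i -[1+ n ] (+ 0) _ ()
  0<i*j⇒0<i+j⇒0<i -[1+ n ] +[1+ k ] () _
  0<i*j⇒0<i+j⇒0<i -[1+ n ] -[1+ k ] _ ()

  0<i⇒0<∣i∣ : ∀ {i} → 0ℤ < i → 0 ℕ.< ∣ i ∣
  0<i⇒0<∣i∣ (+<+ 0<n) = 0<n

  DivisorPair : ℤ → ℕ → Set
  DivisorPair ε n = ∃₂ λ d₁ d₂ → 0 ℕ.< d₁ × 0 ℕ.< d₂ × d₁ ∣ℕ halfSqPlusOne n × d₂ ∣ℕ halfSqPlusOne n ×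
                    (+ d₁) + (+ d₂) ≡ (+ (4 ℕ.* n)) + ε

  SolutionAbove : ℤ → ℕ → Set
  SolutionAbove ε N₀ = ∃ λ n → N₀ ℕ.< n × 0 ℕ.< n × ¬ 2 ∣ℕ n × DivisorPair ε n

  module _ (m t A : ℕ) (e : ℤ) where

    M T : ℤ
    M = + m
    T = + t

    -- The natural numbers X, D and S witness t (u + v) + 2e > 0, v - u ≥ 0 and u + v > 0.
    record Point : Set where
      field
        u v : ℤ
        n X D S : ℕ
        X≡ : + X ≡ T * (u + v) + + 2 * e
        D≡ : + D ≡ v - u
        S≡ : + S ≡ u + v
        4n≡ : + 4 * + n ≡ + A * (u + v) - + 2 * e
        Φ≡0 : Φ M (+ A) e u v ≡ 0ℤ
        0<X : 0 ℕ.< X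
        0<S : 0 ℕ.< S
        n-odd : ¬ 2 ∣ℕ n

    module _ (A+t≡8m : A ℕ.+ t ≡ 8 ℕ.* m) (0<m : 0 ℕ.< m) (0<t : 0 ℕ.< t) (0<A : 0 ℕ.< A)
             (α β : ℕ) (0<α : 0 ℕ.< α)
             (unit : (1 ℕ.+ 8 ℕ.* t ℕ.* α) ℕ.* (1 ℕ.+ 8 ℕ.* t ℕ.* α)
                     ≡ 8 ℕ.* m ℕ.* t ℕ.* ((2 ℕ.* t ℕ.* β) ℕ.* (2 ℕ.* t ℕ.* β)) ℕ.+ 1) where

      N a b : ℤ
      N = + 8 * M * T
      a = 1ℤ + + 8 * T * + α
      b = + 2 * T * + β

      A≡8m-t : + A ≡ + 8 * M - T
      A≡8m-t = trans (cancel (+ A) T) (cong (_- T) (trans (sym (pos-+ A t)) (trans (cong +_ A+t≡8m) (pos-* 8 m))))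
        where
        cancel : ∀ A T → A ≡ (A + T) - T
        cancel = solve-∀

      a²-Nb²≡1 : a * a - N * (b * b) ≡ 1ℤ
      a²-Nb²≡1 = trans (cong₂ _-_ (sym a²≡) (sym Nb²≡)) (trans (cong (λ k → + k - + Nb²) unit) (trans (cong (_- + Nb²) (pos-+ Nb² 1)) (move (+ Nb²))))
        where
        Nb² = 8 ℕ.* m ℕ.* t ℕ.* ((2 ℕ.* t ℕ.* β) ℕ.* (2 ℕ.* t ℕ.* β))
        a²≡ : + ((1 ℕ.+ 8 ℕ.* t ℕ.* α) ℕ.* (1 ℕ.+ 8 ℕ.* t ℕ.* α)) ≡ a * a
        a²≡ = pos-⟦⟧ ((‵ 1 ⊕ ‵ 8 ⊗ ‵ t ⊗ ‵ α) ⊗ (‵ 1 ⊕ ‵ 8 ⊗ ‵ t ⊗ ‵ α))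
        Nb²≡ : + Nb² ≡ N * (b * b)
        Nb²≡ = pos-⟦⟧ (‵ 8 ⊗ ‵ m ⊗ ‵ t ⊗ ((‵ 2 ⊗ ‵ t ⊗ ‵ β) ⊗ (‵ 2 ⊗ ‵ t ⊗ ‵ β)))
        move : ∀ x → x + 1ℤ - x ≡ 1ℤ
        move = solve-∀

      instance
        T≢0 : NonZero T
        T≢0 = ℕ.>-nonZero 0<t

      Ã : ℤ
      Ã = + 8 * M - T

      affine : ℤ → ℤ
      affine r = - Ã * r + + 4 * Ã * (e * e) + + 4 * T * (e * e + + 4)

      -- Multiplying X + D √N by the unit a + b √N preserves X² - N D², hence the zero set of Φ.
      Φ-step : ∀ u v u′ v′ → Φ M (+ A) e u v ≡ 0ℤ →
               T * (u′ + v′) + + 2 * e ≡ a * (T * (u + v) + + 2 * e) + N * b * (v - u) →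
               v′ - u′ ≡ b * (T * (u + v) + + 2 * e) + a * (v - u) →
               Φ M (+ A) e u′ v′ ≡ 0ℤ
      Φ-step u v u′ v′ Φ≡0 X′≡ D′≡ = *-cancelˡ-≡ T (Φ M (+ A) e u′ v′) 0ℤ (begin
        T * Φ M (+ A) e u′ v′                    ≡⟨ cong (λ A′ → T * Φ M A′ e u′ v′) A≡8m-t ⟩
        T * Φ M Ã e u′ v′                        ≡⟨ t*Φ≡ M T e u′ v′ ⟩
        affine (norm (T * (u′ + v′) + + 2 * e) (v′ - u′))
                                                 ≡⟨ cong affine (cong₂ norm X′≡ D′≡) ⟩
        affine (norm (a * X + N * b * D) (b * X + a * D))
                                                 ≡⟨ cong affine (norm-* N a b X D) ⟩
        affine ((a * a - N * (b * b)) * norm X D) ≡⟨ cong (λ r → affine (r * norm X D)) a²-Nb²≡1 ⟩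
        affine (1ℤ * norm X D)                   ≡⟨ cong affine (*-identityˡ (norm X D)) ⟩
        affine (norm X D)                        ≡⟨ t*Φ≡ M T e u v ⟨
        T * Φ M Ã e u v                          ≡⟨ cong (λ A′ → T * Φ M A′ e u v) A≡8m-t ⟨
        T * Φ M (+ A) e u v                      ≡⟨ cong (T *_) Φ≡0 ⟩
        T * 0ℤ                                   ∎)
        where
        open ≡-Reasoning
        X = T * (u + v) + + 2 * e
        D = v - u
        norm : ℤ → ℤ → ℤ
        norm X D = X * X - N * (D * D)

      step : Point → Point
      step P = record
        { u = u + + 4 * + h - + k ; v = v + + 4 * + h + + k
        ; n = 2 ℕ.* (A ℕ.* h) ℕ.+ n ; X = X ℕ.+ 8 ℕ.* t ℕ.* h ; D = D ℕ.+ 2 ℕ.* k ; S = S ℕ.+ 8 ℕ.* h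
        ; X≡ = X′≡ ; D≡ = D′≡ ; S≡ = S′≡ ; 4n≡ = 4n′≡
        ; Φ≡0 = Φ-step u v u′ v′ Φ≡0 X′≡aX+NbD D′≡bX+aD
        ; 0<X = ℕ.≤-trans 0<X (ℕ.m≤m+n X (8 ℕ.* t ℕ.* h))
        ; 0<S = ℕ.≤-trans 0<S (ℕ.m≤m+n S (8 ℕ.* h))
        ; n-odd = λ 2∣n′ → n-odd (∣m+n∣m⇒∣n 2∣n′ (m∣m*n (A ℕ.* h)))
        }
        where
        open Point P
        h k : ℕ
        h = α ℕ.* X ℕ.+ 2 ℕ.* m ℕ.* t ℕ.* β ℕ.* D
        k = t ℕ.* β ℕ.* X ℕ.+ 4 ℕ.* t ℕ.* α ℕ.* D
        u′ v′ 𝕏 𝔻 : ℤ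
        u′ = u + + 4 * + h - + k
        v′ = v + + 4 * + h + + k
        𝕏 = T * (u + v) + + 2 * e
        𝔻 = v - u

        h≡ : + h ≡ + α * 𝕏 + + 2 * M * T * + β * 𝔻
        h≡ = trans (pos-⟦⟧ (‵ α ⊗ ‵ X ⊕ ‵ 2 ⊗ ‵ m ⊗ ‵ t ⊗ ‵ β ⊗ ‵ D))
                   (cong₂ (λ x d → + α * x + + 2 * M * T * + β * d) X≡ D≡)
        k≡ : + k ≡ T * + β * 𝕏 + + 4 * T * + α * 𝔻
        k≡ = trans (pos-⟦⟧ (‵ t ⊗ ‵ β ⊗ ‵ X ⊕ ‵ 4 ⊗ ‵ t ⊗ ‵ α ⊗ ‵ D))
                   (cong₂ (λ x d → T * + β * x + + 4 * T * + α * d) X≡ D≡)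

        X′≡ : + (X ℕ.+ 8 ℕ.* t ℕ.* h) ≡ T * (u′ + v′) + + 2 * e
        X′≡ = trans (pos-⟦⟧ (‵ X ⊕ ‵ 8 ⊗ ‵ t ⊗ ‵ h)) (trans (cong (λ x → x + + 8 * T * + h) X≡) (shape u v e T (+ h) (+ k)))
          where
          shape : ∀ u v e T h k → T * (u + v) + + 2 * e + + 8 * T * h ≡ T * ((u + + 4 * h - k) + (v + + 4 * h + k)) + + 2 * e
          shape = solve-∀
        D′≡ : + (D ℕ.+ 2 ℕ.* k) ≡ v′ - u′
        D′≡ = trans (pos-⟦⟧ (‵ D ⊕ ‵ 2 ⊗ ‵ k)) (trans (cong (λ d → d + + 2 * + k) D≡) (shape u v (+ h) (+ k)))
          where
          shape : ∀ u v h k → v - u + + 2 * k ≡ (v + + 4 * h + k) - (u + + 4 * h - k)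
          shape = solve-∀
        S′≡ : + (S ℕ.+ 8 ℕ.* h) ≡ u′ + v′
        S′≡ = trans (pos-⟦⟧ (‵ S ⊕ ‵ 8 ⊗ ‵ h)) (trans (cong (λ s → s + + 8 * + h) S≡) (shape u v (+ h) (+ k)))
          where
          shape : ∀ u v h k → u + v + + 8 * h ≡ (u + + 4 * h - k) + (v + + 4 * h + k)
          shape = solve-∀
        4n′≡ : + 4 * + (2 ℕ.* (A ℕ.* h) ℕ.+ n) ≡ + A * (u′ + v′) - + 2 * e
        4n′≡ = trans (cong (+ 4 *_) (pos-⟦⟧ (‵ 2 ⊗ (‵ A ⊗ ‵ h) ⊕ ‵ n)))
                 (trans (shift (+ A) (+ h) (+ n)) (trans (cong (λ r → + 8 * + A * + h + r) 4n≡) (shape u v e (+ A) (+ h) (+ k))))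
          where
          shift : ∀ A h n → + 4 * (+ 2 * (A * h) + n) ≡ + 8 * A * h + + 4 * n
          shift = solve-∀
          shape : ∀ u v e A h k → + 8 * A * h + (A * (u + v) - + 2 * e) ≡ A * ((u + + 4 * h - k) + (v + + 4 * h + k)) - + 2 * e
          shape = solve-∀

        X′≡aX+NbD : T * (u′ + v′) + + 2 * e ≡ a * 𝕏 + N * b * 𝔻
        X′≡aX+NbD = trans (sym X′≡) (trans (pos-⟦⟧ (‵ X ⊕ ‵ 8 ⊗ ‵ t ⊗ ‵ h))
                      (trans (cong₂ (λ x h → x + + 8 * T * h) X≡ h≡) (shape 𝕏 𝔻 M T (+ α) (+ β))))
          where
          shape : ∀ X D M T α β → X + + 8 * T * (α * X + + 2 * M * T * β * D)
                  ≡ (1ℤ + + 8 * T * α) * X + + 8 * M * T * (+ 2 * T * β) * D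
          shape = solve-∀
        D′≡bX+aD : v′ - u′ ≡ b * 𝕏 + a * 𝔻
        D′≡bX+aD = trans (sym D′≡) (trans (pos-⟦⟧ (‵ D ⊕ ‵ 2 ⊗ ‵ k))
                     (trans (cong₂ (λ d k → d + + 2 * k) D≡ k≡) (shape 𝕏 𝔻 T (+ α) (+ β))))
          where
          shape : ∀ X D T α β → D + + 2 * (T * β * X + + 4 * T * α * D) ≡ + 2 * T * β * X + (1ℤ + + 8 * T * α) * D
          shape = solve-∀

      n<n∘step : ∀ P → Point.n P ℕ.< Point.n (step P)
      n<n∘step P = ℕ.m<n+m n (ℕ.*-mono-≤ {1} {2} (ℕ.s≤s ℕ.z≤n) (ℕ.*-mono-≤ 0<A (ℕ.≤-trans (ℕ.*-mono-≤ 0<α 0<X) (ℕ.m≤m+n (α ℕ.* X) _))))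
        where open Point P

      step^ : ℕ → Point → Point
      step^ ℕ.zero P = P
      step^ (ℕ.suc j) P = step (step^ j P)

      n+j≤n∘step^j : ∀ j P → Point.n P ℕ.+ j ℕ.≤ Point.n (step^ j P)
      n+j≤n∘step^j ℕ.zero P = ℕ.≤-reflexive (ℕ.+-identityʳ (Point.n P))
      n+j≤n∘step^j (ℕ.suc j) P = ℕ.≤-trans (ℕ.≤-reflexive (ℕ.+-suc (Point.n P) j)) (ℕ.≤-trans (ℕ.s≤s (n+j≤n∘step^j j P)) (n<n∘step (step^ j P)))

      divisor-pair : ∀ P → DivisorPair (+ 2 * e) (Point.n P)
      divisor-pair P = A ℕ.* ∣ u ∣ , A ℕ.* ∣ v ∣ , ℕ.*-mono-≤ 0<A (0<i⇒0<∣i∣ 0<u) , ℕ.*-mono-≤ 0<A (0<i⇒0<∣i∣ 0<v) ,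
                       divides (m ℕ.* ∣ v ∣) (trans half≡ (regroup₁ m A ∣ u ∣ ∣ v ∣)) ,
                       divides (m ℕ.* ∣ u ∣) (trans half≡ (regroup₂ m A ∣ u ∣ ∣ v ∣)) , sum≡
        where
        open Point P
        regroup₁ : ∀ m A u v → m ℕ.* A ℕ.* u ℕ.* v ≡ m ℕ.* v ℕ.* (A ℕ.* u)
        regroup₁ = ℕ-Solver.solve-∀
        regroup₂ : ∀ m A u v → m ℕ.* A ℕ.* u ℕ.* v ≡ m ℕ.* u ℕ.* (A ℕ.* v)
        regroup₂ = ℕ-Solver.solve-∀
        n²+1≡2mAuv : + n * + n + 1ℤ ≡ + 2 * M * + A * u * v
        n²+1≡2mAuv = *-cancelˡ-≡ (+ 16) _ _ (begin
          + 16 * (+ n * + n + 1ℤ)                                  ≡⟨ expand (+ n) ⟩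
          (+ 4 * + n) * (+ 4 * + n) + + 16                         ≡⟨ cong (λ w → w * w + + 16) 4n≡ ⟩
          (+ A * (u + v) - + 2 * e) * (+ A * (u + v) - + 2 * e) + + 16
                                                                  ≡⟨ i-j≡0⇒i≡j _ _ Φ≡0 ⟩
          + 32 * M * + A * u * v                                   ≡⟨ factor M (+ A) u v ⟩
          + 16 * (+ 2 * M * + A * u * v)                           ∎)
          where
          open ≡-Reasoning
          expand : ∀ n → + 16 * (n * n + 1ℤ) ≡ (+ 4 * n) * (+ 4 * n) + + 16
          expand = solve-∀
          factor : ∀ m A u v → + 32 * m * A * u * v ≡ + 16 * (+ 2 * m * A * u * v)
          factor = solve-∀
        0<uv : 0ℤ < u * v
        0<uv = *-cancelˡ-<-nonNeg (+ (2 ℕ.* m ℕ.* A)) (begin-strict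
          + (2 ℕ.* m ℕ.* A) * 0ℤ ≡⟨ *-zeroʳ (+ (2 ℕ.* m ℕ.* A)) ⟩
          0ℤ                     <⟨ +<+ (ℕ.m≤n+m 1 (n ℕ.* n)) ⟩
          + (n ℕ.* n ℕ.+ 1)      ≡⟨ pos-⟦⟧ (‵ n ⊗ ‵ n ⊕ ‵ 1) ⟩
          + n * + n + 1ℤ         ≡⟨ n²+1≡2mAuv ⟩
          + 2 * M * + A * u * v  ≡⟨ *-assoc (+ 2 * M * + A) u v ⟩
          + 2 * M * + A * (u * v) ≡⟨ cong (_* (u * v)) (pos-⟦⟧ (‵ 2 ⊗ ‵ m ⊗ ‵ A)) ⟨
          + (2 ℕ.* m ℕ.* A) * (u * v) ∎)
          where open ≤-Reasoning
        0<u+v : 0ℤ < u + v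
        0<u+v = subst (0ℤ <_) S≡ (+<+ 0<S)
        0<u : 0ℤ < u
        0<u = 0<i*j⇒0<i+j⇒0<i u v 0<uv 0<u+v
        0<v : 0ℤ < v
        0<v = 0<i*j⇒0<i+j⇒0<i v u (subst (0ℤ <_) (*-comm u v) 0<uv) (subst (0ℤ <_) (+-comm u v) 0<u+v)
        ∣u∣≡u : + ∣ u ∣ ≡ u
        ∣u∣≡u = 0≤i⇒+∣i∣≡i (<⇒≤ 0<u)
        ∣v∣≡v : + ∣ v ∣ ≡ v
        ∣v∣≡v = 0≤i⇒+∣i∣≡i (<⇒≤ 0<v)
        half≡ : halfSqPlusOne n ≡ m ℕ.* A ℕ.* ∣ u ∣ ℕ.* ∣ v ∣
        half≡ = trans (cong (ℕ._/ 2) (+-injective n²+1≡)) (m*n/n≡m (m ℕ.* A ℕ.* ∣ u ∣ ℕ.* ∣ v ∣) 2)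
          where
          n²+1≡ : + (n ℕ.* n ℕ.+ 1) ≡ + (m ℕ.* A ℕ.* ∣ u ∣ ℕ.* ∣ v ∣ ℕ.* 2)
          n²+1≡ = begin
            + (n ℕ.* n ℕ.+ 1)                               ≡⟨ pos-⟦⟧ (‵ n ⊗ ‵ n ⊕ ‵ 1) ⟩
            + n * + n + 1ℤ                                  ≡⟨ n²+1≡2mAuv ⟩
            + 2 * M * + A * u * v                           ≡⟨ cong₂ (λ x y → + 2 * M * + A * x * y) ∣u∣≡u ∣v∣≡v ⟨
            + 2 * M * + A * + ∣ u ∣ * + ∣ v ∣               ≡⟨ reorder M (+ A) (+ ∣ u ∣) (+ ∣ v ∣) ⟩
            M * + A * + ∣ u ∣ * + ∣ v ∣ * + 2               ≡⟨ pos-⟦⟧ (‵ m ⊗ ‵ A ⊗ ‵ ∣ u ∣ ⊗ ‵ ∣ v ∣ ⊗ ‵ 2) ⟨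
            + (m ℕ.* A ℕ.* ∣ u ∣ ℕ.* ∣ v ∣ ℕ.* 2)           ∎
            where
            open ≡-Reasoning
            reorder : ∀ m A u v → + 2 * m * A * u * v ≡ m * A * u * v * + 2
            reorder = solve-∀
        sum≡ : + (A ℕ.* ∣ u ∣) + + (A ℕ.* ∣ v ∣) ≡ + (4 ℕ.* n) + + 2 * e
        sum≡ = begin
          + (A ℕ.* ∣ u ∣) + + (A ℕ.* ∣ v ∣)        ≡⟨ cong₂ _+_ (pos-* A ∣ u ∣) (pos-* A ∣ v ∣) ⟩
          + A * + ∣ u ∣ + + A * + ∣ v ∣            ≡⟨ cong₂ (λ x y → + A * x + + A * y) ∣u∣≡u ∣v∣≡v ⟩
          + A * u + + A * v                        ≡⟨ rearrange (+ A) u v e ⟩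
          (+ A * (u + v) - + 2 * e) + + 2 * e      ≡⟨ cong (_+ + 2 * e) 4n≡ ⟨
          + 4 * + n + + 2 * e                      ≡⟨ cong (_+ + 2 * e) (pos-* 4 n) ⟨
          + (4 ℕ.* n) + + 2 * e                    ∎
          where
          open ≡-Reasoning
          rearrange : ∀ A u v e → A * u + A * v ≡ (A * (u + v) - + 2 * e) + + 2 * e
          rearrange = solve-∀

      unbounded : Point → ∀ N₀ → SolutionAbove (+ 2 * e) N₀
      unbounded P N₀ = Point.n Q , N₀<n , ℕ.<-≤-trans ℕ.z<s N₀<n , Point.n-odd Q , divisor-pair Q
        where
        Q = step^ (ℕ.suc N₀) P
        N₀<n : N₀ ℕ.< Point.n Q
        N₀<n = ℕ.≤-trans (ℕ.m≤n+m (ℕ.suc N₀) (Point.n P)) (n+j≤n∘step^j (ℕ.suc N₀) P)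

module Seeds where

  open import Data.Integer hiding (_/_; _%_)
  open import Data.Integer.Properties
  open import Data.Integer.DivMod using (_/_; _%_; a≡a%n+[a/n]*n; n%d<d)
  open import Data.Integer.Divisibility using () renaming (_∣_ to _∣ᵤ_)
  open import Data.Integer.Divisibility.Signed using (_∣_; divides; ∣ᵤ⇒∣; ∣⇒∣ᵤ)
  open import Data.Integer.Tactic.RingSolver using (solve-∀)
  open import Data.Nat as ℕ using (ℕ; s≤s)
  import Data.Nat.Properties as ℕ
  open import Data.Nat.Divisibility using (∣1⇒≡1) renaming (_∣_ to _∣ℕ_; divides to dividesℕ)
  import Data.Nat.Tactic.RingSolver as ℕ-Solver
  open import Data.Empty using (⊥-elim)
  open import Data.Product using (∃; ∃₂; _×_; _,_)
  open import Data.Sum using (_⊎_; inj₁; inj₂)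
  open import Relation.Nullary using (¬_)
  open import Relation.Binary.PropositionalEquality

  open Cast
  open Nonsquare
  open Pell using (pell)
  open Orbit

  odd⇒0< : ∀ {n} → ¬ 2 ∣ℕ n → 0 ℕ.< n
  odd⇒0< {ℕ.zero} 2∤0 = ⊥-elim (2∤0 (dividesℕ 0 refl))
  odd⇒0< {ℕ.suc n} _ = ℕ.z<s

  pos≡1+2h⇒odd : ∀ {n} h → + n ≡ 1ℤ + + 2 * h → ¬ 2 ∣ℕ n
  pos≡1+2h⇒odd {n} h n≡1+2h (dividesℕ q n≡q*2) = 2≢1 (∣1⇒≡1 (∣⇒∣ᵤ (divides (+ q - h) 1≡[q-h]*2)))
    where
    2≢1 : 2 ≢ 1
    2≢1 ()

    1≡[q-h]*2 : 1ℤ ≡ (+ q - h) * + 2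
    1≡[q-h]*2 = trans (rearrange h) (trans (cong (_- + 2 * h) (trans (sym n≡1+2h) (trans (cong +_ n≡q*2) (pos-* q 2))))
                  (expand (+ q) h))
      where
      rearrange : ∀ h → 1ℤ ≡ 1ℤ + + 2 * h - + 2 * h
      rearrange = solve-∀
      expand : ∀ q h → q * + 2 - + 2 * h ≡ (q - h) * + 2
      expand = solve-∀

  0<m*n : ∀ {m n} → 0 ℕ.< m → 0 ℕ.< n → 0 ℕ.< m ℕ.* n
  0<m*n 0<m 0<n = ℕ.*-mono-≤ 0<m 0<n

  -- (x + 2ty√N)² = a + b√N with N = 8mt, a = 1 + 8tα and b = 2tβ.
  pell-unit : ∀ m t x y → x ℕ.* x ≡ 32 ℕ.* m ℕ.* (t ℕ.* t ℕ.* t) ℕ.* (y ℕ.* y) ℕ.+ 1 →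
    let α = 8 ℕ.* m ℕ.* t ℕ.* t ℕ.* (y ℕ.* y) ; β = 2 ℕ.* x ℕ.* y in
    (1 ℕ.+ 8 ℕ.* t ℕ.* α) ℕ.* (1 ℕ.+ 8 ℕ.* t ℕ.* α) ≡ 8 ℕ.* m ℕ.* t ℕ.* ((2 ℕ.* t ℕ.* β) ℕ.* (2 ℕ.* t ℕ.* β)) ℕ.+ 1
  pell-unit m t x y x²≡ = begin
    (1 ℕ.+ 8 ℕ.* t ℕ.* (8 ℕ.* m ℕ.* t ℕ.* t ℕ.* (y ℕ.* y))) ℕ.* (1 ℕ.+ 8 ℕ.* t ℕ.* (8 ℕ.* m ℕ.* t ℕ.* t ℕ.* (y ℕ.* y)))
        ≡⟨ lhs m t y ⟩
    128 ℕ.* m ℕ.* (t ℕ.* t ℕ.* t) ℕ.* (y ℕ.* y) ℕ.* (32 ℕ.* m ℕ.* (t ℕ.* t ℕ.* t) ℕ.* (y ℕ.* y) ℕ.+ 1) ℕ.+ 1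
        ≡⟨ cong (λ z → 128 ℕ.* m ℕ.* (t ℕ.* t ℕ.* t) ℕ.* (y ℕ.* y) ℕ.* z ℕ.+ 1) x²≡ ⟨
    128 ℕ.* m ℕ.* (t ℕ.* t ℕ.* t) ℕ.* (y ℕ.* y) ℕ.* (x ℕ.* x) ℕ.+ 1
        ≡⟨ rhs m t x y ⟩
    8 ℕ.* m ℕ.* t ℕ.* ((2 ℕ.* t ℕ.* (2 ℕ.* x ℕ.* y)) ℕ.* (2 ℕ.* t ℕ.* (2 ℕ.* x ℕ.* y))) ℕ.+ 1 ∎
    where
    open ≡-Reasoning
    lhs : ∀ m t y → (1 ℕ.+ 8 ℕ.* t ℕ.* (8 ℕ.* m ℕ.* t ℕ.* t ℕ.* (y ℕ.* y))) ℕ.* (1 ℕ.+ 8 ℕ.* t ℕ.* (8 ℕ.* m ℕ.* t ℕ.* t ℕ.* (y ℕ.* y)))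
          ≡ 128 ℕ.* m ℕ.* (t ℕ.* t ℕ.* t) ℕ.* (y ℕ.* y) ℕ.* (32 ℕ.* m ℕ.* (t ℕ.* t ℕ.* t) ℕ.* (y ℕ.* y) ℕ.+ 1) ℕ.+ 1
    lhs = ℕ-Solver.solve-∀
    rhs : ∀ m t x y → 128 ℕ.* m ℕ.* (t ℕ.* t ℕ.* t) ℕ.* (y ℕ.* y) ℕ.* (x ℕ.* x) ℕ.+ 1
          ≡ 8 ℕ.* m ℕ.* t ℕ.* ((2 ℕ.* t ℕ.* (2 ℕ.* x ℕ.* y)) ℕ.* (2 ℕ.* t ℕ.* (2 ℕ.* x ℕ.* y))) ℕ.+ 1
    rhs = ℕ-Solver.solve-∀

  32mt³-nonsquare : ∀ m t → ¬ 2 ∣ℕ m → ¬ 2 ∣ℕ t →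
                    ∀ p q → 0 ℕ.< q → p ℕ.* p ≢ 32 ℕ.* m ℕ.* (t ℕ.* t ℕ.* t) ℕ.* (q ℕ.* q)
  32mt³-nonsquare m t 2∤m 2∤t p q 0<q p²≡ =
    p*p≢2*o*[q*q] (m ℕ.* t ℕ.* t ℕ.* t) 2∤mt³ (4 ℕ.* q) (0<m*n {4} {q} ℕ.z<s 0<q) p (trans p²≡ (regroup m t q))
    where
    2∤mt³ : ¬ 2 ∣ℕ m ℕ.* t ℕ.* t ℕ.* t
    2∤mt³ = ¬2∣m⇒¬2∣n⇒¬2∣m*n _ t (¬2∣m⇒¬2∣n⇒¬2∣m*n _ t (¬2∣m⇒¬2∣n⇒¬2∣m*n m t 2∤m 2∤t) 2∤t) 2∤t
    regroup : ∀ m t q → 32 ℕ.* m ℕ.* (t ℕ.* t ℕ.* t) ℕ.* (q ℕ.* q) ≡ 2 ℕ.* (m ℕ.* t ℕ.* t ℕ.* t) ℕ.* (4 ℕ.* q ℕ.* (4 ℕ.* q))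
    regroup = ℕ-Solver.solve-∀

  record Start (e : ℤ) : Set where
    field
      m t A : ℕ
      A+t≡8m : A ℕ.+ t ≡ 8 ℕ.* m
      m-odd : ¬ 2 ∣ℕ m
      t-odd : ¬ 2 ∣ℕ t
      0<A : 0 ℕ.< A
      point : Point m t A e

  unbounded-from : ∀ {e} → Start e → ∀ N₀ → SolutionAbove (+ 2 * e) N₀
  unbounded-from {e} S = from-pell (pell (32 ℕ.* m ℕ.* (t ℕ.* t ℕ.* t)) (32mt³-nonsquare m t m-odd t-odd))
    where
    open Start S
    0<m : 0 ℕ.< m
    0<m = odd⇒0< m-odd
    0<t : 0 ℕ.< t
    0<t = odd⇒0< t-odd
    from-pell : (∃₂ λ x y → 0 ℕ.< y × x ℕ.* x ≡ 32 ℕ.* m ℕ.* (t ℕ.* t ℕ.* t) ℕ.* (y ℕ.* y) ℕ.+ 1) →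
                ∀ N₀ → SolutionAbove (+ 2 * e) N₀
    from-pell (x , y , 0<y , x²≡) = unbounded m t A e A+t≡8m 0<m 0<t 0<A α β 0<α (pell-unit m t x y x²≡) point
      where
      α β : ℕ
      α = 8 ℕ.* m ℕ.* t ℕ.* t ℕ.* (y ℕ.* y)
      β = 2 ℕ.* x ℕ.* y
      0<α : 0 ℕ.< α
      0<α = 0<m*n {8 ℕ.* m ℕ.* t ℕ.* t} (0<m*n {8 ℕ.* m ℕ.* t} (0<m*n {8 ℕ.* m} (0<m*n {8} ℕ.z<s 0<m) 0<t) 0<t) (0<m*n {y} 0<y 0<y)

  -- A starting point given by polynomial certificates: natural numbers are written as sums of squares.
  record Seed (e : ℤ) : Set where
    field
      m t A n X D S : Term
      u v hm ht hn : ℤ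
      A+t≡8m : ⟦ A ⟧ℤ + ⟦ t ⟧ℤ ≡ + 8 * ⟦ m ⟧ℤ
      m≡1+2hm : ⟦ m ⟧ℤ ≡ 1ℤ + + 2 * hm
      t≡1+2ht : ⟦ t ⟧ℤ ≡ 1ℤ + + 2 * ht
      n≡1+2hn : ⟦ n ⟧ℤ ≡ 1ℤ + + 2 * hn
      X≡ : ⟦ X ⟧ℤ ≡ ⟦ t ⟧ℤ * (u + v) + + 2 * e
      D≡ : ⟦ D ⟧ℤ ≡ v - u
      S≡ : ⟦ S ⟧ℤ ≡ u + v
      4n≡ : + 4 * ⟦ n ⟧ℤ ≡ ⟦ A ⟧ℤ * (u + v) - + 2 * e
      Φ≡0 : Φ ⟦ m ⟧ℤ ⟦ A ⟧ℤ e u v ≡ 0ℤ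
      0<A : 0 ℕ.< ⟦ A ⟧ℕ
      0<X : 0 ℕ.< ⟦ X ⟧ℕ
      0<S : 0 ℕ.< ⟦ S ⟧ℕ

  start : ∀ {e} → Seed e → Start e
  start {e} σ = record
    { m = ⟦ m ⟧ℕ ; t = ⟦ t ⟧ℕ ; A = ⟦ A ⟧ℕ
    ; A+t≡8m = +-injective (trans (pos-⟦⟧ (A ⊕ t)) (trans A+t≡8m (sym (pos-⟦⟧ (‵ 8 ⊗ m)))))
    ; m-odd = pos≡1+2h⇒odd hm (trans (pos-⟦⟧ m) m≡1+2hm)
    ; t-odd = pos≡1+2h⇒odd ht (trans (pos-⟦⟧ t) t≡1+2ht)
    ; 0<A = 0<A
    ; point = record
      { u = u ; v = v ; n = ⟦ n ⟧ℕ ; X = ⟦ X ⟧ℕ ; D = ⟦ D ⟧ℕ ; S = ⟦ S ⟧ℕ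
      ; X≡ = trans (pos-⟦⟧ X) (trans X≡ (cong (λ τ → τ * (u + v) + + 2 * e) (sym (pos-⟦⟧ t))))
      ; D≡ = trans (pos-⟦⟧ D) D≡
      ; S≡ = trans (pos-⟦⟧ S) S≡
      ; 4n≡ = trans (cong (+ 4 *_) (pos-⟦⟧ n)) (trans 4n≡ (cong (λ a → a * (u + v) - + 2 * e) (sym (pos-⟦⟧ A))))
      ; Φ≡0 = trans (cong₂ (λ μ a → Φ μ a e u v) (pos-⟦⟧ m) (pos-⟦⟧ A)) Φ≡0
      ; 0<X = 0<X
      ; 0<S = 0<S
      ; n-odd = pos≡1+2h⇒odd hn (trans (pos-⟦⟧ n) n≡1+2hn)
      }
    }
    where open Seed σ

  seed-6[8] : ∀ j → Seed (+ 4 * j + + 3)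
  seed-6[8] j = record
    { m = □ j ⊕ □ (j + + 1)
    ; t = □ (+ 4 * j + + 2) ⊕ ‵ 3
    ; A = ‵ 1
    ; n = □ (+ 3 * j + + 3) ⊕ ‵ 7 ⊗ □ j
    ; X = □ ((+ 4 * j + + 2) * (+ 8 * j + + 5)) ⊕ □ (+ 21 * j + + 12) ⊕ □ (+ 4 * j + + 2) ⊕ ‵ 7 ⊗ □ j ⊕ ‵ 52
    ; D = □ (+ 8 * j + + 5) ⊕ ‵ 15
    ; S = □ (+ 8 * j + + 5) ⊕ ‵ 17
    ; u = + 1 ; v = + 64 * j * j + + 80 * j + + 41
    ; hm = j * j + j ; ht = + 8 * j * j + + 8 * j + + 3 ; hn = + 8 * j * j + + 9 * j + + 4
    ; A+t≡8m = e₁ j ; m≡1+2hm = e₂ j ; t≡1+2ht = e₃ j ; n≡1+2hn = e₄ j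
    ; X≡ = e₅ j ; D≡ = e₆ j ; S≡ = e₇ j ; 4n≡ = e₈ j ; Φ≡0 = e₉ j
    ; 0<A = ℕ.z<s ; 0<X = ℕ.<-≤-trans ℕ.z<s (ℕ.m≤n+m 52 _) ; 0<S = ℕ.<-≤-trans ℕ.z<s (ℕ.m≤n+m 17 _)
    }
    where
    e₁ : ∀ j → + 1 + ((+ 4 * j + + 2) * (+ 4 * j + + 2) + + 3) ≡ + 8 * (j * j + (j + + 1) * (j + + 1))
    e₁ = solve-∀
    e₂ : ∀ j → j * j + (j + + 1) * (j + + 1) ≡ + 1 + + 2 * (j * j + j)
    e₂ = solve-∀
    e₃ : ∀ j → (+ 4 * j + + 2) * (+ 4 * j + + 2) + + 3 ≡ + 1 + + 2 * (+ 8 * j * j + + 8 * j + + 3)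
    e₃ = solve-∀
    e₄ : ∀ j → (+ 3 * j + + 3) * (+ 3 * j + + 3) + + 7 * (j * j) ≡ + 1 + + 2 * (+ 8 * j * j + + 9 * j + + 4)
    e₄ = solve-∀
    e₅ : ∀ j → ((+ 4 * j + + 2) * (+ 8 * j + + 5)) * ((+ 4 * j + + 2) * (+ 8 * j + + 5)) + (+ 21 * j + + 12) * (+ 21 * j + + 12)
               + (+ 4 * j + + 2) * (+ 4 * j + + 2) + + 7 * (j * j) + + 52
             ≡ ((+ 4 * j + + 2) * (+ 4 * j + + 2) + + 3) * (+ 1 + (+ 64 * j * j + + 80 * j + + 41)) + + 2 * (+ 4 * j + + 3)
    e₅ = solve-∀
    e₆ : ∀ j → (+ 8 * j + + 5) * (+ 8 * j + + 5) + + 15 ≡ (+ 64 * j * j + + 80 * j + + 41) - + 1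
    e₆ = solve-∀
    e₇ : ∀ j → (+ 8 * j + + 5) * (+ 8 * j + + 5) + + 17 ≡ + 1 + (+ 64 * j * j + + 80 * j + + 41)
    e₇ = solve-∀
    e₈ : ∀ j → + 4 * ((+ 3 * j + + 3) * (+ 3 * j + + 3) + + 7 * (j * j))
             ≡ + 1 * (+ 1 + (+ 64 * j * j + + 80 * j + + 41)) - + 2 * (+ 4 * j + + 3)
    e₈ = solve-∀
    e₉ : ∀ j → let m = j * j + (j + + 1) * (j + + 1) ; e = + 4 * j + + 3 ; v = + 64 * j * j + + 80 * j + + 41 in
         (+ 1 * (+ 1 + v) - + 2 * e) * (+ 1 * (+ 1 + v) - + 2 * e) + + 16 - + 32 * m * + 1 * + 1 * v ≡ + 0
    e₉ = solve-∀

  seed-2[8] : ∀ j → Seed (+ 4 * j + + 1)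
  seed-2[8] j = record
    { m = ‵ 2 ⊗ □ (+ 2 * j * j) ⊕ ‵ 4 ⊗ □ j ⊕ ‵ 1
    ; t = ‵ 64 ⊗ □ (j * j) ⊕ ‵ 8 ⊗ □ j ⊕ ‵ 2 ⊗ □ (+ 2 * j - + 1) ⊕ ‵ 1
    ; A = □ (+ 4 * j + + 1) ⊕ ‵ 4
    ; n = □ (+ 8 * j * j) ⊕ ‵ 7 ⊗ □ (+ 2 * j) ⊕ ‵ 7
    ; X = □ (+ 8 * j * j * (+ 4 * j - + 1)) ⊕ ‵ 5 ⊗ □ (+ 8 * j * j) ⊕ □ ((+ 4 * j - + 1) * (+ 4 * j - + 1))
          ⊕ ‵ 2 ⊗ □ (+ 6 * j - + 2) ⊕ ‵ 40 ⊗ □ j ⊕ ‵ 11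
    ; D = □ (+ 4 * j - + 1) ⊕ ‵ 3
    ; S = □ (+ 4 * j - + 1) ⊕ ‵ 5
    ; u = + 1 ; v = + 16 * j * j - + 8 * j + + 5
    ; hm = + 4 * (j * j * j * j) + + 2 * (j * j)
    ; ht = + 32 * (j * j * j * j) + + 4 * (j * j) + (+ 2 * j - + 1) * (+ 2 * j - + 1)
    ; hn = + 32 * (j * j * j * j) + + 14 * (j * j) + + 3
    ; A+t≡8m = e₁ j ; m≡1+2hm = e₂ j ; t≡1+2ht = e₃ j ; n≡1+2hn = e₄ j
    ; X≡ = e₅ j ; D≡ = e₆ j ; S≡ = e₇ j ; 4n≡ = e₈ j ; Φ≡0 = e₉ j
    ; 0<A = ℕ.<-≤-trans ℕ.z<s (ℕ.m≤n+m 4 _) ; 0<X = ℕ.<-≤-trans ℕ.z<s (ℕ.m≤n+m 11 _) ; 0<S = ℕ.<-≤-trans ℕ.z<s (ℕ.m≤n+m 5 _)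
    }
    where
    e₁ : ∀ j → (+ 4 * j + + 1) * (+ 4 * j + + 1) + + 4
               + (+ 64 * ((j * j) * (j * j)) + + 8 * (j * j) + + 2 * ((+ 2 * j - + 1) * (+ 2 * j - + 1)) + + 1)
             ≡ + 8 * (+ 2 * ((+ 2 * j * j) * (+ 2 * j * j)) + + 4 * (j * j) + + 1)
    e₁ = solve-∀
    e₂ : ∀ j → + 2 * ((+ 2 * j * j) * (+ 2 * j * j)) + + 4 * (j * j) + + 1 ≡ + 1 + + 2 * (+ 4 * (j * j * j * j) + + 2 * (j * j))
    e₂ = solve-∀
    e₃ : ∀ j → + 64 * ((j * j) * (j * j)) + + 8 * (j * j) + + 2 * ((+ 2 * j - + 1) * (+ 2 * j - + 1)) + + 1
             ≡ + 1 + + 2 * (+ 32 * (j * j * j * j) + + 4 * (j * j) + (+ 2 * j - + 1) * (+ 2 * j - + 1))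
    e₃ = solve-∀
    e₄ : ∀ j → (+ 8 * j * j) * (+ 8 * j * j) + + 7 * ((+ 2 * j) * (+ 2 * j)) + + 7 ≡ + 1 + + 2 * (+ 32 * (j * j * j * j) + + 14 * (j * j) + + 3)
    e₄ = solve-∀
    e₅ : ∀ j → (+ 8 * j * j * (+ 4 * j - + 1)) * (+ 8 * j * j * (+ 4 * j - + 1)) + + 5 * ((+ 8 * j * j) * (+ 8 * j * j))
               + ((+ 4 * j - + 1) * (+ 4 * j - + 1)) * ((+ 4 * j - + 1) * (+ 4 * j - + 1))
               + + 2 * ((+ 6 * j - + 2) * (+ 6 * j - + 2)) + + 40 * (j * j) + + 11
             ≡ (+ 64 * ((j * j) * (j * j)) + + 8 * (j * j) + + 2 * ((+ 2 * j - + 1) * (+ 2 * j - + 1)) + + 1)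
               * (+ 1 + (+ 16 * j * j - + 8 * j + + 5)) + + 2 * (+ 4 * j + + 1)
    e₅ = solve-∀
    e₆ : ∀ j → (+ 4 * j - + 1) * (+ 4 * j - + 1) + + 3 ≡ (+ 16 * j * j - + 8 * j + + 5) - + 1
    e₆ = solve-∀
    e₇ : ∀ j → (+ 4 * j - + 1) * (+ 4 * j - + 1) + + 5 ≡ + 1 + (+ 16 * j * j - + 8 * j + + 5)
    e₇ = solve-∀
    e₈ : ∀ j → + 4 * ((+ 8 * j * j) * (+ 8 * j * j) + + 7 * ((+ 2 * j) * (+ 2 * j)) + + 7)
             ≡ ((+ 4 * j + + 1) * (+ 4 * j + + 1) + + 4) * (+ 1 + (+ 16 * j * j - + 8 * j + + 5)) - + 2 * (+ 4 * j + + 1)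
    e₈ = solve-∀
    e₉ : ∀ j → let m = + 2 * ((+ 2 * j * j) * (+ 2 * j * j)) + + 4 * (j * j) + + 1 ; A = (+ 4 * j + + 1) * (+ 4 * j + + 1) + + 4
                   e = + 4 * j + + 1 ; v = + 16 * j * j - + 8 * j + + 5 in
         (A * (+ 1 + v) - + 2 * e) * (A * (+ 1 + v) - + 2 * e) + + 16 - + 32 * m * A * + 1 * v ≡ + 0
    e₉ = solve-∀

  ε≡2[8]⊎ε≡6[8] : ∀ ε → + 4 ∣ᵤ ε - + 2 → ∃ λ j → ε ≡ + 2 * (+ 4 * j + + 1) ⊎ ε ≡ + 2 * (+ 4 * j + + 3)
  ε≡2[8]⊎ε≡6[8] ε 4∣ε-2 = from-quotient (∣ᵤ⇒∣ 4∣ε-2)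
    where
    from-quotient : + 4 ∣ ε - + 2 → ∃ λ j → ε ≡ + 2 * (+ 4 * j + + 1) ⊎ ε ≡ + 2 * (+ 4 * j + + 3)
    from-quotient (divides k ε-2≡k*4) = by-remainder (k % + 2) (n%d<d k (+ 2)) (a≡a%n+[a/n]*n k (+ 2))
      where
      j = k / + 2
      ε≡ : ∀ r → k ≡ + r + j * + 2 → ε ≡ (+ r + j * + 2) * + 4 + + 2
      ε≡ r k≡ = trans (split ε) (cong (_+ + 2) (trans ε-2≡k*4 (cong (_* + 4) k≡)))
        where
        split : ∀ ε → ε ≡ (ε - + 2) + + 2
        split = solve-∀
      by-remainder : ∀ r → r ℕ.< 2 → k ≡ + r + j * + 2 → ∃ λ j → ε ≡ + 2 * (+ 4 * j + + 1) ⊎ ε ≡ + 2 * (+ 4 * j + + 3)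
      by-remainder 0 _ k≡ = j , inj₁ (trans (ε≡ 0 k≡) (regroup₀ j))
        where
        regroup₀ : ∀ j → (+ 0 + j * + 2) * + 4 + + 2 ≡ + 2 * (+ 4 * j + + 1)
        regroup₀ = solve-∀
      by-remainder 1 _ k≡ = j , inj₂ (trans (ε≡ 1 k≡) (regroup₁ j))
        where
        regroup₁ : ∀ j → (+ 1 + j * + 2) * + 4 + + 2 ≡ + 2 * (+ 4 * j + + 3)
        regroup₁ = solve-∀
      by-remainder (ℕ.suc (ℕ.suc r)) (s≤s (s≤s ())) _

open import Defs
open import Data.Nat using (ℕ; _<_; _*_)
open import Data.Nat.Divisibility using (_∣_)
open import Data.Integer using (ℤ; +_; _-_; _+_)
open import Data.Integer.Divisibility using () renaming (_∣_ to _∣ℤ_)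
open import Data.Product using (_×_; _,_; ∃-syntax)
open import Data.Sum using (inj₁; inj₂)
open import Relation.Nullary using (¬_)
open import Relation.Binary.PropositionalEquality using (_≡_; subst; sym)
open Orbit using (SolutionAbove)
open Seeds using (ε≡2[8]⊎ε≡6[8]; unbounded-from; start; seed-2[8]; seed-6[8])

theorem2 : (ε : ℤ) → (+ 4) ∣ℤ (ε - + 2) →
    (N : ℕ) → ∃[ n ] (N < n × 0 < n × ¬ (2 ∣ n) ×
      ∃[ d₁ ] ∃[ d₂ ] (0 < d₁ × 0 < d₂ × d₁ ∣ halfSqPlusOne n × d₂ ∣ halfSqPlusOne n ×
        (+ d₁) + (+ d₂) ≡ (+ (4 * n)) + ε))
theorem2 ε 4∣ε-2 N with ε≡2[8]⊎ε≡6[8] ε 4∣ε-2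
... | j , inj₁ ε≡ = subst (λ ε → SolutionAbove ε N) (sym ε≡) (unbounded-from (start (seed-2[8] j)) N)
... | j , inj₂ ε≡ = subst (λ ε → SolutionAbove ε N) (sym ε≡) (unbounded-from (start (seed-6[8] j)) N)
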